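{- Let $P_{(1,1,0)}$ be the set of all cylindric partitions with profile $c=(1,1,0)$. Then, as formal power series in $q$, $$\sum_{\Lambda\in P_{(1,1,0)}} q^{|\Lambda|}=\left(\sum_{n\ge0}\frac{q^{n^2}}{(q^4;q^4)_n}\right)\frac{(-q^2;q^2)_\infty}{(q;q)_\infty}.$$
   Context: Let $r,\ell$ be positive integers and $c=(c_1,\dots,c_r)$ a composition of $\ell$ into $r$ nonnegative integer parts (zero entries allowed). A cylindric partition with profile $c$ is a tuple $\Lambda=(\lambda^{(1)},\dots,\lambda^{(r)})$ of ordinary partitions $\lambda^{(i)}=(\lambda^{(i)}_1\ge\lambda^{(i)}_2\ge\cdots)$ (parts beyond the length are taken to be $0$) such that for all $i,j$: $\lambda^{(i)}_j\ge\lambda^{(i+1)}_{j+c_{i+1}}$ for $1\le i\le r-1$, and $\lambda^{(r)}_j\ge\lambda^{(1)}_{j+c_1}$. The size $|\Lambda|$ is the sum of all parts of all $\lambda^{(i)}$; the empty cylindric partition is included with size $0$. Notation: $(a;q)_n=\prod_{k=1}^n(1-aq^{k-1})$, $(a;q)_\infty=\lim_{n\to\infty}(a;q)_n$. -}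

module Defs where

open import Data.Nat as ℕ using (ℕ; zero; suc; _∸_; _<?_)
open import Data.Integer as ℤ using (ℤ; +_)
open import Data.Fin using (Fin; zero; suc; toℕ; fromℕ<)
open import Data.Vec using (Vec; []; _∷_; lookup; toList)
open import Data.List using (List; []; _∷_; _++_; length; map)
open import Data.Nat.ListAction using (sum)
open import Data.List.Relation.Unary.All using (All)
open import Data.List.Relation.Unary.Linked using (Linked)
open import Data.List.Relation.Unary.Unique.Propositional using (Unique)
open import Data.List.Membership.Propositional using (_∈_)
open import Data.Product using (Σ; _×_)
open import Function.Bundles using (_⇔_)
open import Relation.Binary.PropositionalEquality using (_≡_)
open import Relation.Nullary using (yes; no)

IsPartition : List ℕ → Set
IsPartition xs = Linked ℕ._≥_ xs × All (ℕ._<_ 0) xs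

part : List ℕ → ℕ → ℕ
part []       _       = 0
part (x ∷ _)  zero    = x
part (_ ∷ xs) (suc j) = part xs j

cycSuc : ∀ {m} → Fin (suc m) → Fin (suc m)
cycSuc {m} i with toℕ i <? m
... | yes p = suc (fromℕ< p)
... | no _  = zero

-- Cylindric partition with profile c = (c_1,…,c_r), r = suc m.
-- (Using 0-indexed parts and 0-indexed components; the condition
--  λ^(i)_j ≥ λ^(i+1)_(j + c_(i+1)), indices of components cyclic.)
IsCylindric : ∀ {m} → Vec ℕ (suc m) → Vec (List ℕ) (suc m) → Set
IsCylindric {m} c Λ =
  ((i : Fin (suc m)) → IsPartition (lookup Λ i)) ×
  ((i : Fin (suc m)) (j : ℕ) →
     part (lookup Λ (cycSuc i)) (j ℕ.+ lookup c (cycSuc i)) ℕ.≤ part (lookup Λ i) j)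

size : ∀ {r} → Vec (List ℕ) r → ℕ
size Λ = sum (map sum (toList Λ))

-- "exactly k objects satisfy P": a duplicate-free list of length k
-- enumerating precisely the x with P x.
HasCount : {A : Set} → (A → Set) → ℕ → Set
HasCount {A} P k =
  Σ (List A) λ xs → (length xs ≡ k) × Unique xs × ((x : A) → (x ∈ xs) ⇔ P x)

FPS : Set
FPS = ℕ → ℤ

infixl 7 _*ₛ_
infixl 6 _+ₛ_ _-ₛ_

sumTo : ℕ → (ℕ → ℤ) → ℤ
sumTo zero    f = f 0
sumTo (suc n) f = sumTo n f ℤ.+ f (suc n)

oneS : FPS
oneS zero    = + 1
oneS (suc _) = + 0

mono : ℕ → FPS
mono zero    zero    = + 1
mono zero    (suc _) = + 0
mono (suc k) zero    = + 0
mono (suc k) (suc n) = mono k n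

_+ₛ_ : FPS → FPS → FPS
(a +ₛ b) n = a n ℤ.+ b n

-ₛ_ : FPS → FPS
(-ₛ a) n = ℤ.- a n

_-ₛ_ : FPS → FPS → FPS
a -ₛ b = a +ₛ (-ₛ b)

_*ₛ_ : FPS → FPS → FPS
(a *ₛ b) n = sumTo n (λ i → a i ℤ.* b (n ∸ i))

powS : FPS → ℕ → FPS
powS b zero    = oneS
powS b (suc k) = powS b k *ₛ b

nth : List ℤ → ℕ → ℤ
nth []       _       = + 0
nth (x ∷ _)  zero    = x
nth (_ ∷ xs) (suc n) = nth xs n

-- coefficients b_0,…,b_n of the multiplicative inverse of a series a
-- with constant term 1:  b_0 = 1,  b_n = - Σ_{i=1}^{n} a_i b_{n-i}.
invList : FPS → ℕ → List ℤ
invList a zero    = + 1 ∷ []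
invList a (suc n) =
  let bs = invList a n in
  bs ++ (ℤ.- sumTo n (λ i → a (suc i) ℤ.* nth bs (n ∸ i)) ∷ [])

-- multiplicative inverse (for series with constant term 1)
invS : FPS → FPS
invS a n = nth (invList a n) n

poch : FPS → FPS → ℕ → FPS
poch a b zero    = oneS
poch a b (suc n) = poch a b n *ₛ (oneS -ₛ (a *ₛ powS b n))

-- (a; b)_∞ for a, b with zero constant term: coefficient n is the
-- (stable) coefficient n of the finite product with n+1 factors.
pochInf : FPS → FPS → FPS
pochInf a b n = poch a b (suc n) n

-- Σ_{m ≥ 0} g m, for g m divisible by q^m: coefficient n is the (stable)
-- coefficient n of the partial sum over m ≤ n.
infSum : (ℕ → FPS) → FPS
infSum g n = sumTo n (λ m → g m n)

profile110 : Vec ℕ 3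
profile110 = 1 ∷ 1 ∷ 0 ∷ []

rhs110 : FPS
rhs110 =
  (infSum (λ n → mono (n ℕ.* n) *ₛ invS (poch (mono 4) (mono 4) n)))
  *ₛ pochInf (-ₛ mono 2) (mono 2)
  *ₛ invS (pochInf (mono 1) (mono 1))

module Submission where

-- Reading a cylindric partition with profile (1,1,0) column by column: the heights of its
-- first columns form a shape (a , b , c) with c ≤ b ≤ a + 1 ≤ c + 2, and removing these columns
-- leaves a cylindric partition of componentwise smaller shape. The nonzero such shapes come in
-- pairs of each weight k + 1 and are ordered by weight, except that the two "true" shapes of
-- consecutive weights are incomparable. Hence, if G k counts the partitions whose first columns
-- have total height at most k, then R k = (q;q)_k G k satisfies R (k+2) = R (k+1) + q^(k+2) R k:
-- it is the Fibonacci polynomial of the subsets of {1, …, k} without two consecutive elements,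
-- and the partitions of size n are counted by the coefficient of q^n in R n / (q;q)_n.
--
-- On the other side, (q⁴;q⁴)_n = (q²;q²)_n (-q²;q²)_n, Euler's expansion of (-q^(2n+2);q²)_∞ and
-- Σ_{i+j=s} q^j / ((q²;q²)_i (q²;q²)_j) = 1 / (q;q)_s turn Σ_n q^(n²) / (q⁴;q⁴)_n · (-q²;q²)_∞
-- into the Rogers–Ramanujan sum Σ_s q^(s²) / (q;q)_s, and the functional equation of
-- Σ_s q^(sj+s²) / (q;q)_s identifies the Rogers–Ramanujan sum with the same Fibonacci polynomials
-- up to q^N. Every identity is proved up to q^N only, which is all a single coefficient needs.

module PowerSeries where

  open import Defs
  open import Level using (0ℓ)
  open import Data.Nat as ℕ using (ℕ; zero; suc; _∸_; z≤n; s≤s; _≤_; _<_)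
  import Data.Nat.Properties as ℕ
  open import Data.Integer as ℤ using (ℤ; +_; -_) renaming (_+_ to _+ᶻ_; _*_ to _*ᶻ_)
  import Data.Integer.Properties as ℤ
  open import Data.Integer.Tactic.RingSolver using (solve-∀)
  open import Data.List using (List; []; _∷_; _++_; length)
  import Data.List.Properties as List
  open import Data.Maybe using (Maybe; just; nothing)
  open import Data.Product using (_,_)
  open import Relation.Binary.PropositionalEquality
  open import Relation.Binary.Bundles using (Setoid)
  open import Relation.Nullary using (yes; no)
  open import Algebra.Bundles using (CommutativeRing)
  open import Algebra.Solver.Ring.AlmostCommutativeRing
    using (AlmostCommutativeRing; fromCommutativeRing; _-Raw-AlmostCommutative⟶_)
  import Relation.Binary.Reasoning.Setoid as SetoidReasoning

  infix 4 _≈_ _≈[_]_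

  -- Records rather than plain Π-types, so that both series can be inferred from a proof.
  record _≈_ (f g : FPS) : Set where
    constructor mk≈
    field at : ∀ n → f n ≡ g n
  open _≈_ public

  record _≈[_]_ (f : FPS) (N : ℕ) (g : FPS) : Set where
    constructor mk≈[]
    field at≤ : ∀ n → n ≤ N → f n ≡ g n
  open _≈[_]_ public

  zeroS : FPS
  zeroS _ = + 0

  sumTo-cong≤ : ∀ n {f g : ℕ → ℤ} → (∀ i → i ≤ n → f i ≡ g i) → sumTo n f ≡ sumTo n g
  sumTo-cong≤ zero    f≡g = f≡g 0 z≤n
  sumTo-cong≤ (suc n) f≡g =
    cong₂ _+ᶻ_ (sumTo-cong≤ n (λ i i≤n → f≡g i (ℕ.m≤n⇒m≤1+n i≤n))) (f≡g (suc n) ℕ.≤-refl)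

  sumTo-cong : ∀ n {f g : ℕ → ℤ} → (∀ i → f i ≡ g i) → sumTo n f ≡ sumTo n g
  sumTo-cong n f≡g = sumTo-cong≤ n (λ i _ → f≡g i)

  sumTo-+ : ∀ n (f g : ℕ → ℤ) → sumTo n (λ i → f i +ᶻ g i) ≡ sumTo n f +ᶻ sumTo n g
  sumTo-+ zero    f g = refl
  sumTo-+ (suc n) f g =
    trans (cong (_+ᶻ (f (suc n) +ᶻ g (suc n))) (sumTo-+ n f g))
          (swap (sumTo n f) (sumTo n g) (f (suc n)) (g (suc n)))
    where
    swap : ∀ a b c d → (a +ᶻ b) +ᶻ (c +ᶻ d) ≡ (a +ᶻ c) +ᶻ (b +ᶻ d)
    swap = solve-∀

  sumTo-*ˡ : ∀ n c (f : ℕ → ℤ) → c *ᶻ sumTo n f ≡ sumTo n (λ i → c *ᶻ f i)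
  sumTo-*ˡ zero    c f = refl
  sumTo-*ˡ (suc n) c f = trans (ℤ.*-distribˡ-+ c _ _) (cong (_+ᶻ c *ᶻ f (suc n)) (sumTo-*ˡ n c f))

  sumTo-neg : ∀ n (f : ℕ → ℤ) → - sumTo n f ≡ sumTo n (λ i → - f i)
  sumTo-neg zero    f = refl
  sumTo-neg (suc n) f = trans (ℤ.neg-distrib-+ (sumTo n f) _) (cong (_+ᶻ - f (suc n)) (sumTo-neg n f))

  sumTo-zeros : ∀ n (f : ℕ → ℤ) → (∀ i → i ≤ n → f i ≡ + 0) → sumTo n f ≡ + 0
  sumTo-zeros zero    f f≡0 = f≡0 0 z≤n
  sumTo-zeros (suc n) f f≡0 =
    cong₂ _+ᶻ_ (sumTo-zeros n f (λ i i≤n → f≡0 i (ℕ.m≤n⇒m≤1+n i≤n))) (f≡0 (suc n) ℕ.≤-refl)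

  sumTo-head : ∀ n (f : ℕ → ℤ) → sumTo (suc n) f ≡ f 0 +ᶻ sumTo n (λ i → f (suc i))
  sumTo-head zero    f = refl
  sumTo-head (suc n) f = trans (cong (_+ᶻ f (suc (suc n))) (sumTo-head n f)) (ℤ.+-assoc (f 0) _ _)

  sumTo-reverse : ∀ n (f : ℕ → ℤ) → sumTo n f ≡ sumTo n (λ i → f (n ∸ i))
  sumTo-reverse zero    f = refl
  sumTo-reverse (suc n) f = begin
    sumTo (suc n) f
      ≡⟨ sumTo-head n f ⟩
    f 0 +ᶻ sumTo n (λ i → f (suc i))
      ≡⟨ cong (f 0 +ᶻ_) (sumTo-reverse n (λ i → f (suc i))) ⟩
    f 0 +ᶻ sumTo n (λ i → f (suc (n ∸ i)))
      ≡⟨ ℤ.+-comm (f 0) _ ⟩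
    sumTo n (λ i → f (suc (n ∸ i))) +ᶻ f 0
      ≡⟨ cong₂ _+ᶻ_ (sumTo-cong≤ n (λ i i≤n → cong f (sym (ℕ.+-∸-assoc 1 i≤n))))
                     (cong f (sym (ℕ.n∸n≡0 (suc n)))) ⟩
    sumTo (suc n) (λ i → f (suc n ∸ i)) ∎
    where open ≡-Reasoning

  sumTo-triangle : ∀ n (g : ℕ → ℕ → ℤ) →
    sumTo n (λ k → sumTo k (λ i → g i k)) ≡ sumTo n (λ i → sumTo (n ∸ i) (λ j → g i (i ℕ.+ j)))
  sumTo-triangle zero    g = refl
  sumTo-triangle (suc n) g = begin
    sumTo n (λ k → sumTo k (λ i → g i k)) +ᶻ sumTo (suc n) (λ i → g i (suc n))
      ≡⟨ cong (_+ᶻ sumTo (suc n) (λ i → g i (suc n))) (sumTo-triangle n g) ⟩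
    Rows n +ᶻ (sumTo n (λ i → g i (suc n)) +ᶻ g (suc n) (suc n))
      ≡⟨ sym (ℤ.+-assoc (Rows n) _ _) ⟩
    (Rows n +ᶻ sumTo n (λ i → g i (suc n))) +ᶻ g (suc n) (suc n)
      ≡⟨ cong₂ _+ᶻ_ (trans (sym (sumTo-+ n _ _)) (sumTo-cong≤ n extendRow))
                    (cong (g (suc n)) (sym (ℕ.+-identityʳ (suc n)))) ⟩
    sumTo n (λ i → Row (suc n) i) +ᶻ g (suc n) (suc n ℕ.+ 0)
      ≡⟨ cong (λ m → sumTo n (λ i → Row (suc n) i) +ᶻ sumTo m (λ j → g (suc n) (suc n ℕ.+ j)))
              (sym (ℕ.n∸n≡0 (suc n))) ⟩
    sumTo (suc n) (λ i → Row (suc n) i) ∎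
    where
    open ≡-Reasoning
    Row : ℕ → ℕ → ℤ
    Row m i = sumTo (m ∸ i) (λ j → g i (i ℕ.+ j))
    Rows : ℕ → ℤ
    Rows m = sumTo m (Row m)
    extendRow : ∀ i → i ≤ n → Row n i +ᶻ g i (suc n) ≡ Row (suc n) i
    extendRow i i≤n rewrite ℕ.+-∸-assoc 1 i≤n =
      cong (Row n i +ᶻ_) (cong (g i) (sym (trans (ℕ.+-suc i (n ∸ i)) (cong suc (ℕ.m+[n∸m]≡n i≤n)))))

  sumTo-extend : ∀ n N (f : ℕ → ℤ) → n ≤ N → (∀ m → n < m → f m ≡ + 0) → sumTo N f ≡ sumTo n f
  sumTo-extend n N f n≤N f≡0 =
    trans (cong (λ x → sumTo x f) (sym (ℕ.m+[n∸m]≡n n≤N))) (extendBy (N ∸ n))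
    where
    extendBy : ∀ k → sumTo (n ℕ.+ k) f ≡ sumTo n f
    extendBy zero    = cong (λ x → sumTo x f) (ℕ.+-identityʳ n)
    extendBy (suc k) = begin
      sumTo (n ℕ.+ suc k) f                  ≡⟨ cong (λ x → sumTo x f) (ℕ.+-suc n k) ⟩
      sumTo (n ℕ.+ k) f +ᶻ f (suc (n ℕ.+ k))  ≡⟨ cong₂ _+ᶻ_ (extendBy k) (f≡0 _ (s≤s (ℕ.m≤m+n n k))) ⟩
      sumTo n f +ᶻ + 0                       ≡⟨ ℤ.+-identityʳ _ ⟩
      sumTo n f                              ∎
      where open ≡-Reasoning

  *ₛ-cong : ∀ {a a′ b b′} → a ≈ a′ → b ≈ b′ → a *ₛ b ≈ a′ *ₛ b′
  *ₛ-cong a≈a′ b≈b′ = mk≈ λ n → sumTo-cong n (λ i → cong₂ _*ᶻ_ (at a≈a′ i) (at b≈b′ (n ∸ i)))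

  *ₛ-comm : ∀ a b → a *ₛ b ≈ b *ₛ a
  *ₛ-comm a b = mk≈ λ n → trans (sumTo-reverse n _) (sumTo-cong≤ n (λ i i≤n →
    trans (cong (λ m → a (n ∸ i) *ᶻ b m) (ℕ.m∸[m∸n]≡n i≤n)) (ℤ.*-comm (a (n ∸ i)) (b i))))

  *ₛ-assoc : ∀ a b c → (a *ₛ b) *ₛ c ≈ a *ₛ (b *ₛ c)
  *ₛ-assoc a b c = mk≈ λ n → begin
    sumTo n (λ k → sumTo k (λ i → a i *ᶻ b (k ∸ i)) *ᶻ c (n ∸ k))
      ≡⟨ sumTo-cong n (λ k → *-sumTo k (c (n ∸ k)) (λ i → a i *ᶻ b (k ∸ i))) ⟩
    sumTo n (λ k → sumTo k (λ i → a i *ᶻ b (k ∸ i) *ᶻ c (n ∸ k)))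
      ≡⟨ sumTo-triangle n (λ i k → a i *ᶻ b (k ∸ i) *ᶻ c (n ∸ k)) ⟩
    sumTo n (λ i → sumTo (n ∸ i) (λ j → a i *ᶻ b ((i ℕ.+ j) ∸ i) *ᶻ c (n ∸ (i ℕ.+ j))))
      ≡⟨ sumTo-cong n (λ i → sumTo-cong (n ∸ i) (λ j →
           trans (cong₂ (λ u v → a i *ᶻ b u *ᶻ c v) (ℕ.m+n∸m≡n i j) (sym (ℕ.∸-+-assoc n i j)))
                 (ℤ.*-assoc (a i) _ _))) ⟩
    sumTo n (λ i → sumTo (n ∸ i) (λ j → a i *ᶻ (b j *ᶻ c ((n ∸ i) ∸ j))))
      ≡⟨ sumTo-cong n (λ i → sym (sumTo-*ˡ (n ∸ i) (a i) _)) ⟩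
    sumTo n (λ i → a i *ᶻ sumTo (n ∸ i) (λ j → b j *ᶻ c ((n ∸ i) ∸ j))) ∎
    where
    open ≡-Reasoning
    *-sumTo : ∀ m d (f : ℕ → ℤ) → sumTo m f *ᶻ d ≡ sumTo m (λ i → f i *ᶻ d)
    *-sumTo m d f = trans (ℤ.*-comm (sumTo m f) d)
                          (trans (sumTo-*ˡ m d f) (sumTo-cong m (λ i → ℤ.*-comm d (f i))))

  *ₛ-distribˡ : ∀ a b c → a *ₛ (b +ₛ c) ≈ a *ₛ b +ₛ a *ₛ c
  *ₛ-distribˡ a b c = mk≈ λ n →
    trans (sumTo-cong n (λ i → ℤ.*-distribˡ-+ (a i) (b (n ∸ i)) (c (n ∸ i)))) (sumTo-+ n _ _)

  *ₛ-distribʳ : ∀ a b c → (b +ₛ c) *ₛ a ≈ b *ₛ a +ₛ c *ₛ a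
  *ₛ-distribʳ a b c = mk≈ λ n →
    trans (sumTo-cong n (λ i → ℤ.*-distribʳ-+ (a (n ∸ i)) (b i) (c i))) (sumTo-+ n _ _)

  *ₛ-identityˡ : ∀ a → oneS *ₛ a ≈ a
  *ₛ-identityˡ a = mk≈ λ where
    zero    → ℤ.*-identityˡ (a 0)
    (suc n) → trans (sumTo-head n _)
                    (trans (cong₂ _+ᶻ_ (ℤ.*-identityˡ (a (suc n))) (sumTo-zeros n _ (λ _ _ → refl)))
                           (ℤ.+-identityʳ _))

  *ₛ-identityʳ : ∀ a → a *ₛ oneS ≈ a
  *ₛ-identityʳ a = mk≈ λ n → trans (at (*ₛ-comm a oneS) n) (at (*ₛ-identityˡ a) n)

  ring : CommutativeRing 0ℓ 0ℓ
  ring = record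
    { Carrier = FPS ; _≈_ = _≈_ ; _+_ = _+ₛ_ ; _*_ = _*ₛ_ ; -_ = -ₛ_ ; 0# = zeroS ; 1# = oneS
    ; isCommutativeRing = record
      { isRing = record
        { +-isAbelianGroup = record
          { isGroup = record
            { isMonoid = record
              { isSemigroup = record
                { isMagma = record
                  { isEquivalence = record
                    { refl  = mk≈ (λ _ → refl)
                    ; sym   = λ p → mk≈ (λ n → sym (at p n))
                    ; trans = λ p q → mk≈ (λ n → trans (at p n) (at q n)) }
                  ; ∙-cong = λ p q → mk≈ (λ n → cong₂ _+ᶻ_ (at p n) (at q n)) }
                ; assoc = λ a b c → mk≈ (λ n → ℤ.+-assoc (a n) (b n) (c n)) }
              ; identity = (λ a → mk≈ (λ n → ℤ.+-identityˡ (a n)))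
                         , (λ a → mk≈ (λ n → ℤ.+-identityʳ (a n))) }
            ; inverse = (λ a → mk≈ (λ n → ℤ.+-inverseˡ (a n)))
                      , (λ a → mk≈ (λ n → ℤ.+-inverseʳ (a n)))
            ; ⁻¹-cong = λ p → mk≈ (λ n → cong -_ (at p n)) }
          ; comm = λ a b → mk≈ (λ n → ℤ.+-comm (a n) (b n)) }
        ; *-cong = *ₛ-cong
        ; *-assoc = *ₛ-assoc
        ; *-identity = *ₛ-identityˡ , *ₛ-identityʳ
        ; distrib = *ₛ-distribˡ , *ₛ-distribʳ }
      ; *-comm = *ₛ-comm } }

  module R = CommutativeRing ring
  module ≈-Reasoning = SetoidReasoning R.setoid

  -- Series are functions, so unification cannot recover the fixed factor: it is explicit.
  *ₛ-congˡ : ∀ a {b b′} → b ≈ b′ → a *ₛ b ≈ a *ₛ b′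
  *ₛ-congˡ a = *ₛ-cong (R.refl {a})

  *ₛ-congʳ : ∀ b {a a′} → a ≈ a′ → a *ₛ b ≈ a′ *ₛ b
  *ₛ-congʳ b a≈a′ = *ₛ-cong a≈a′ (R.refl {b})

  +ₛ-congˡ : ∀ a {b b′} → b ≈ b′ → a +ₛ b ≈ a +ₛ b′
  +ₛ-congˡ a = R.+-cong (R.refl {a})

  +ₛ-congʳ : ∀ b {a a′} → a ≈ a′ → a +ₛ b ≈ a′ +ₛ b
  +ₛ-congʳ b a≈a′ = R.+-cong a≈a′ (R.refl {b})

  private
    constant′ : ℤ → FPS
    constant′ c zero    = c
    constant′ c (suc _) = + 0

  -- The constants 0 and 1 are sent to zeroS and oneS themselves, so that
  -- the solver's :con (+ 1) is definitionally oneS.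
  constant : ℤ → FPS
  constant (+ 0) = zeroS
  constant (+ 1) = oneS
  constant c     = constant′ c

  private
    constant≗ : ∀ c n → constant c n ≡ constant′ c n
    constant≗ (+ 0)           zero    = refl
    constant≗ (+ 0)           (suc n) = refl
    constant≗ (+ 1)           zero    = refl
    constant≗ (+ 1)           (suc n) = refl
    constant≗ (+ suc (suc m)) n       = refl
    constant≗ ℤ.-[1+ m ]      n       = refl

    constant′-* : ∀ c d n → constant′ (c *ᶻ d) n ≡ (constant′ c *ₛ constant′ d) n
    constant′-* c d zero    = refl
    constant′-* c d (suc n) =
      sym (trans (sumTo-head n _) (cong₂ _+ᶻ_ (ℤ.*-zeroʳ c) (sumTo-zeros n _ (λ _ _ → refl))))

    constant′-+ : ∀ c d n → constant′ (c +ᶻ d) n ≡ constant′ c n +ᶻ constant′ d n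
    constant′-+ c d zero    = refl
    constant′-+ c d (suc n) = refl

    constant′-neg : ∀ c n → constant′ (- c) n ≡ - constant′ c n
    constant′-neg c zero    = refl
    constant′-neg c (suc n) = refl

    constant≈ : ∀ c → constant c ≈ constant′ c
    constant≈ c = mk≈ (constant≗ c)

  almostRing : AlmostCommutativeRing 0ℓ 0ℓ
  almostRing = fromCommutativeRing ring

  constant-homomorphism : CommutativeRing.rawRing ℤ.+-*-commutativeRing -Raw-AlmostCommutative⟶ almostRing
  constant-homomorphism = record
    { ⟦_⟧    = constant
    ; +-homo = λ c d → R.trans (constant≈ (c +ᶻ d))
        (R.trans (mk≈ (constant′-+ c d)) (R.sym (R.+-cong (constant≈ c) (constant≈ d))))
    ; *-homo = λ c d → R.trans (constant≈ (c *ᶻ d))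
        (R.trans (mk≈ (constant′-* c d)) (R.sym (*ₛ-cong (constant≈ c) (constant≈ d))))
    ; -‿homo = λ c → R.trans (constant≈ (- c))
        (R.trans (mk≈ (constant′-neg c)) (R.sym (R.-‿cong (constant≈ c))))
    ; 0-homo = R.refl
    ; 1-homo = R.refl }

  constant-≟ : (c d : ℤ) → Maybe (constant c ≈ constant d)
  constant-≟ c d with c ℤ.≟ d
  ... | yes refl = just R.refl
  ... | no _     = nothing

  open import Algebra.Solver.Ring (CommutativeRing.rawRing ℤ.+-*-commutativeRing) almostRing
    constant-homomorphism constant-≟ public
    using (_:+_; _:*_; _:-_; :-_; _:=_; solve) renaming (con to :con)

  ≈⇒≈[] : ∀ {N a b} → a ≈ b → a ≈[ N ] b
  ≈⇒≈[] a≈b = mk≈[] (λ n _ → at a≈b n)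

  ≈[]⇒≈ : ∀ {a b} → (∀ N → a ≈[ N ] b) → a ≈ b
  ≈[]⇒≈ a≈b = mk≈ λ n → at≤ (a≈b n) n ℕ.≤-refl

  ≈[]-setoid : ℕ → Setoid 0ℓ 0ℓ
  ≈[]-setoid N = record
    { Carrier = FPS
    ; _≈_ = _≈[ N ]_
    ; isEquivalence = record
      { refl  = mk≈[] (λ _ _ → refl)
      ; sym   = λ p → mk≈[] (λ n n≤N → sym (at≤ p n n≤N))
      ; trans = λ p q → mk≈[] (λ n n≤N → trans (at≤ p n n≤N) (at≤ q n n≤N)) } }

  module ≈[]-Reasoning (N : ℕ) = SetoidReasoning (≈[]-setoid N)

  ≈[]-refl : ∀ {N a} → a ≈[ N ] a
  ≈[]-refl {N} = Setoid.refl (≈[]-setoid N)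

  ≈[]-sym : ∀ {N a b} → a ≈[ N ] b → b ≈[ N ] a
  ≈[]-sym {N} = Setoid.sym (≈[]-setoid N)

  ≈[]-trans : ∀ {N a b c} → a ≈[ N ] b → b ≈[ N ] c → a ≈[ N ] c
  ≈[]-trans {N} = Setoid.trans (≈[]-setoid N)

  +ₛ-cong[] : ∀ {N a a′ b b′} → a ≈[ N ] a′ → b ≈[ N ] b′ → a +ₛ b ≈[ N ] a′ +ₛ b′
  +ₛ-cong[] p q = mk≈[] λ n n≤N → cong₂ _+ᶻ_ (at≤ p n n≤N) (at≤ q n n≤N)

  *ₛ-cong[] : ∀ {N a a′ b b′} → a ≈[ N ] a′ → b ≈[ N ] b′ → a *ₛ b ≈[ N ] a′ *ₛ b′
  *ₛ-cong[] p q = mk≈[] λ n n≤N → sumTo-cong≤ n (λ i i≤n →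
    cong₂ _*ᶻ_ (at≤ p i (ℕ.≤-trans i≤n n≤N)) (at≤ q (n ∸ i) (ℕ.≤-trans (ℕ.m∸n≤m n i) n≤N)))

  *ₛ-congˡ[] : ∀ {N} a {b b′} → b ≈[ N ] b′ → a *ₛ b ≈[ N ] a *ₛ b′
  *ₛ-congˡ[] a = *ₛ-cong[] (≈[]-refl {a = a})

  *ₛ-congʳ[] : ∀ {N} b {a a′} → a ≈[ N ] a′ → a *ₛ b ≈[ N ] a′ *ₛ b
  *ₛ-congʳ[] b p = *ₛ-cong[] p (≈[]-refl {a = b})

  q^_∣_ : ℕ → FPS → Set
  q^ a ∣ f = ∀ n → n < a → f n ≡ + 0

  q^∣-weaken : ∀ {a b f} → b ≤ a → q^ a ∣ f → q^ b ∣ f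
  q^∣-weaken b≤a a∣f n n<b = a∣f n (ℕ.<-≤-trans n<b b≤a)

  q^∣-*ₛ : ∀ {a b f g} → q^ a ∣ f → q^ b ∣ g → q^ (a ℕ.+ b) ∣ (f *ₛ g)
  q^∣-*ₛ {a} {b} {f} {g} a∣f b∣g n n<a+b = sumTo-zeros n _ term≡0
    where
    term≡0 : ∀ i → i ≤ n → f i *ᶻ g (n ∸ i) ≡ + 0
    term≡0 i i≤n with i ℕ.<? a
    ... | yes i<a = cong (_*ᶻ g (n ∸ i)) (a∣f i i<a)
    ... | no  i≮a = trans (cong (f i *ᶻ_) (b∣g (n ∸ i) n∸i<b)) (ℤ.*-zeroʳ (f i))
      where
      n∸i<b : n ∸ i < b
      n∸i<b = ℕ.+-cancelˡ-< i (n ∸ i) b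
        (ℕ.<-≤-trans (subst (_< a ℕ.+ b) (sym (ℕ.m+[n∸m]≡n i≤n)) n<a+b) (ℕ.+-monoˡ-≤ b (ℕ.≮⇒≥ i≮a)))

  q^∣mono : ∀ a → q^ a ∣ mono a
  q^∣mono (suc a) zero    _         = refl
  q^∣mono (suc a) (suc n) (s≤s n<a) = q^∣mono a n n<a

  q^∣mono-*ₛ : ∀ a f → q^ a ∣ (mono a *ₛ f)
  q^∣mono-*ₛ a f =
    q^∣-weaken (ℕ.≤-reflexive (sym (ℕ.+-identityʳ a))) (q^∣-*ₛ {a} {0} {mono a} {f} (q^∣mono a) (λ _ ()))

  mono-zero : mono 0 ≈ oneS
  mono-zero = mk≈ λ where
    zero    → refl
    (suc n) → refl

  mono-≡ : ∀ {a b} → a ≡ b → mono a ≈ mono b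
  mono-≡ refl = R.refl

  mono-suc-*ₛ : ∀ a f n → (mono (suc a) *ₛ f) (suc n) ≡ (mono a *ₛ f) n
  mono-suc-*ₛ a f n =
    trans (sumTo-head n _) (trans (cong (_+ᶻ rest) (ℤ.*-zeroˡ (f (suc n)))) (ℤ.+-identityˡ rest))
    where rest = sumTo n (λ i → mono a i *ᶻ f (n ∸ i))

  mono-*ₛ-shift : ∀ a f n → (mono a *ₛ f) (a ℕ.+ n) ≡ f n
  mono-*ₛ-shift zero    f n = trans (at (*ₛ-congʳ f mono-zero) n) (at (*ₛ-identityˡ f) n)
  mono-*ₛ-shift (suc a) f n = trans (mono-suc-*ₛ a f (a ℕ.+ n)) (mono-*ₛ-shift a f n)

  mono-+ : ∀ a b → mono a *ₛ mono b ≈ mono (a ℕ.+ b)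
  mono-+ zero    b = R.trans (*ₛ-congʳ (mono b) mono-zero) (*ₛ-identityˡ (mono b))
  mono-+ (suc a) b = mk≈ λ where
    zero    → q^∣mono-*ₛ (suc a) (mono b) 0 (s≤s z≤n)
    (suc n) → trans (mono-suc-*ₛ a (mono b) n) (at (mono-+ a b) n)

  mono-+-*ₛ : ∀ a b f → mono a *ₛ (mono b *ₛ f) ≈ mono (a ℕ.+ b) *ₛ f
  mono-+-*ₛ a b f = R.trans (R.sym (*ₛ-assoc (mono a) (mono b) f)) (*ₛ-congʳ f (mono-+ a b))

  powS-mono : ∀ c k → powS (mono c) k ≈ mono (k ℕ.* c)
  powS-mono c zero    = R.sym mono-zero
  powS-mono c (suc k) =
    R.trans (*ₛ-congʳ (mono c) (powS-mono c k)) (R.trans (mono-+ (k ℕ.* c) c) (mono-≡ (ℕ.+-comm (k ℕ.* c) c)))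

  sumₛ : ℕ → (ℕ → FPS) → FPS
  sumₛ M h n = sumTo M (λ m → h m n)

  sumₛ-cong : ∀ M {h h′} → (∀ m → m ≤ M → h m ≈ h′ m) → sumₛ M h ≈ sumₛ M h′
  sumₛ-cong M h≈h′ = mk≈ λ n → sumTo-cong≤ M (λ m m≤M → at (h≈h′ m m≤M) n)

  sumₛ-cong[] : ∀ {N} M {h h′} → (∀ m → m ≤ M → h m ≈[ N ] h′ m) → sumₛ M h ≈[ N ] sumₛ M h′
  sumₛ-cong[] M h≈h′ = mk≈[] λ n n≤N → sumTo-cong≤ M (λ m m≤M → at≤ (h≈h′ m m≤M) n n≤N)

  sumₛ-+ : ∀ M h h′ → sumₛ M (λ m → h m +ₛ h′ m) ≈ sumₛ M h +ₛ sumₛ M h′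
  sumₛ-+ M h h′ = mk≈ λ n → sumTo-+ M (λ m → h m n) (λ m → h′ m n)

  sumₛ--ₛ : ∀ M h h′ → sumₛ M (λ m → h m -ₛ h′ m) ≈ sumₛ M h -ₛ sumₛ M h′
  sumₛ--ₛ M h h′ = mk≈ λ n →
    trans (sumTo-+ M (λ m → h m n) (λ m → - h′ m n))
          (cong (sumTo M (λ m → h m n) +ᶻ_) (sym (sumTo-neg M (λ m → h′ m n))))

  sumₛ-*ˡ : ∀ M c h → c *ₛ sumₛ M h ≈ sumₛ M (λ m → c *ₛ h m)
  sumₛ-*ˡ zero    c h = R.refl
  sumₛ-*ˡ (suc M) c h =
    R.trans (*ₛ-distribˡ c (sumₛ M h) (h (suc M))) (+ₛ-congʳ (c *ₛ h (suc M)) (sumₛ-*ˡ M c h))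

  sumₛ-*ʳ : ∀ M c h → sumₛ M h *ₛ c ≈ sumₛ M (λ m → h m *ₛ c)
  sumₛ-*ʳ M c h =
    R.trans (*ₛ-comm (sumₛ M h) c) (R.trans (sumₛ-*ˡ M c h) (sumₛ-cong M (λ m _ → *ₛ-comm c (h m))))

  sumₛ-head : ∀ M h → sumₛ (suc M) h ≈ h 0 +ₛ sumₛ M (λ m → h (suc m))
  sumₛ-head M h = mk≈ λ n → sumTo-head M (λ m → h m n)

  sumₛ-reverse : ∀ M h → sumₛ M h ≈ sumₛ M (λ m → h (M ∸ m))
  sumₛ-reverse M h = mk≈ λ n → sumTo-reverse M (λ m → h m n)

  sumₛ-triangle : ∀ n (g : ℕ → ℕ → FPS) →
    sumₛ n (λ k → sumₛ k (λ i → g i k)) ≈ sumₛ n (λ i → sumₛ (n ∸ i) (λ j → g i (i ℕ.+ j)))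
  sumₛ-triangle n g = mk≈ λ x → sumTo-triangle n (λ i k → g i k x)

  sumₛ-extend : ∀ {N} M M′ h → M ≤ M′ → (∀ m → M < m → q^ suc N ∣ h m) → sumₛ M′ h ≈[ N ] sumₛ M h
  sumₛ-extend M M′ h M≤M′ big = mk≈[] λ n n≤N →
    sumTo-extend M M′ (λ m → h m n) M≤M′ (λ m M<m → big m M<m n (s≤s n≤N))

  infSum≈[]sumₛ : ∀ N g → (∀ m → q^ m ∣ g m) → infSum g ≈[ N ] sumₛ N g
  infSum≈[]sumₛ N g m∣g = mk≈[] λ n n≤N →
    sym (sumTo-extend n N (λ m → g m n) n≤N (λ m n<m → m∣g m n n<m))

  sumₛ-recurrence : ∀ M c (t t′ t″ : ℕ → FPS) →
    t 0 ≈ t′ 0 → (∀ k → t (suc k) ≈ t′ (suc k) +ₛ c *ₛ t″ k) →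
    sumₛ (suc M) t ≈ sumₛ (suc M) t′ +ₛ c *ₛ sumₛ M t″
  sumₛ-recurrence M c t t′ t″ t₀≈t′₀ step = begin
    sumₛ (suc M) t
      ≈⟨ sumₛ-head M t ⟩
    t 0 +ₛ sumₛ M (λ k → t (suc k))
      ≈⟨ R.+-cong t₀≈t′₀ (R.trans (sumₛ-cong M (λ k _ → step k)) (sumₛ-+ M _ _)) ⟩
    t′ 0 +ₛ (sumₛ M (λ k → t′ (suc k)) +ₛ sumₛ M (λ k → c *ₛ t″ k))
      ≈⟨ R.sym (R.+-assoc (t′ 0) _ _) ⟩
    (t′ 0 +ₛ sumₛ M (λ k → t′ (suc k))) +ₛ sumₛ M (λ k → c *ₛ t″ k)
      ≈⟨ R.+-cong (R.sym (sumₛ-head M t′)) (R.sym (sumₛ-*ˡ M c t″)) ⟩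
    sumₛ (suc M) t′ +ₛ c *ₛ sumₛ M t″ ∎
    where open ≈-Reasoning

  sumₛ-stable : ∀ N t → (∀ k → q^ k ∣ t k) → sumₛ (suc N) t ≈[ N ] sumₛ N t
  sumₛ-stable N t k∣t = sumₛ-extend N (suc N) t (ℕ.n≤1+n N) (λ k N<k → q^∣-weaken N<k (k∣t k))

  sumₛ-recurrence[] : ∀ N c (t t′ t″ : ℕ → FPS) →
    (∀ k → q^ k ∣ t k) → (∀ k → q^ k ∣ t′ k) →
    t 0 ≈ t′ 0 → (∀ k → t (suc k) ≈ t′ (suc k) +ₛ c *ₛ t″ k) →
    sumₛ N t ≈[ N ] sumₛ N t′ +ₛ c *ₛ sumₛ N t″
  sumₛ-recurrence[] N c t t′ t″ k∣t k∣t′ t₀≈t′₀ step = begin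
    sumₛ N t                              ≈⟨ ≈[]-sym (sumₛ-stable N t k∣t) ⟩
    sumₛ (suc N) t                        ≈⟨ ≈⇒≈[] (sumₛ-recurrence N c t t′ t″ t₀≈t′₀ step) ⟩
    sumₛ (suc N) t′ +ₛ c *ₛ sumₛ N t″     ≈⟨ +ₛ-cong[] (sumₛ-stable N t′ k∣t′) ≈[]-refl ⟩
    sumₛ N t′ +ₛ c *ₛ sumₛ N t″           ∎
    where open ≈[]-Reasoning N

  private
    length-invList : ∀ a n → length (invList a n) ≡ suc n
    length-invList a zero    = refl
    length-invList a (suc n) =
      trans (List.length-++ (invList a n)) (trans (cong (ℕ._+ 1) (length-invList a n)) (ℕ.+-comm (suc n) 1))

    nth-++ : ∀ (xs ys : List ℤ) m → m < length xs → nth (xs ++ ys) m ≡ nth xs m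
    nth-++ (x ∷ xs) ys zero    _         = refl
    nth-++ (x ∷ xs) ys (suc m) (s≤s m<n) = nth-++ xs ys m m<n

    nth-last : ∀ (xs : List ℤ) y → nth (xs ++ y ∷ []) (length xs) ≡ y
    nth-last []       y = refl
    nth-last (x ∷ xs) y = nth-last xs y

    nth-invList : ∀ a n m → m ≤ n → nth (invList a n) m ≡ invS a m
    nth-invList a zero    zero z≤n = refl
    nth-invList a (suc n) m m≤1+n with m ℕ.≟ suc n
    ... | yes refl = refl
    ... | no  m≢   = trans (nth-++ (invList a n) _ m (subst (m <_) (sym (length-invList a n)) (s≤s m≤n)))
                           (nth-invList a n m m≤n)
      where m≤n = ℕ.≤-pred (ℕ.≤∧≢⇒< m≤1+n m≢)

  invS-suc : ∀ a n → invS a (suc n) ≡ - sumTo n (λ i → a (suc i) *ᶻ invS a (n ∸ i))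
  invS-suc a n =
    trans (subst (λ L → nth (invList a n ++ x ∷ []) L ≡ x) (length-invList a n) (nth-last (invList a n) x))
          (cong -_ (sumTo-cong≤ n (λ i _ → cong (a (suc i) *ᶻ_) (nth-invList a n (n ∸ i) (ℕ.m∸n≤m n i)))))
    where x = - sumTo n (λ i → a (suc i) *ᶻ nth (invList a n) (n ∸ i))

  invS-inverseʳ : ∀ a → a 0 ≡ + 1 → a *ₛ invS a ≈ oneS
  invS-inverseʳ a a₀≡1 = mk≈ λ where
      zero    → cong (_*ᶻ + 1) a₀≡1
      (suc n) → higher n
    where
    open ≡-Reasoning
    higher : ∀ n → (a *ₛ invS a) (suc n) ≡ + 0
    higher n = begin
      (a *ₛ invS a) (suc n)
        ≡⟨ sumTo-head n _ ⟩
      a 0 *ᶻ invS a (suc n) +ᶻ S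
        ≡⟨ cong (_+ᶻ S) (trans (cong₂ _*ᶻ_ a₀≡1 (invS-suc a n)) (ℤ.*-identityˡ _)) ⟩
      - S +ᶻ S
        ≡⟨ ℤ.+-inverseˡ S ⟩
      + 0 ∎
      where S = sumTo n (λ i → a (suc i) *ᶻ invS a (n ∸ i))

  invS-inverseˡ : ∀ a → a 0 ≡ + 1 → invS a *ₛ a ≈ oneS
  invS-inverseˡ a a₀≡1 = R.trans (*ₛ-comm (invS a) a) (invS-inverseʳ a a₀≡1)

  invS-unique[] : ∀ {N} a b → a 0 ≡ + 1 → a *ₛ b ≈[ N ] oneS → b ≈[ N ] invS a
  invS-unique[] {N} a b a₀≡1 ab≈1 = begin
    b                     ≈⟨ ≈⇒≈[] (R.sym (*ₛ-identityʳ b)) ⟩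
    b *ₛ oneS             ≈⟨ ≈⇒≈[] (*ₛ-congˡ b (R.sym (invS-inverseʳ a a₀≡1))) ⟩
    b *ₛ (a *ₛ invS a)    ≈⟨ ≈⇒≈[] (R.sym (*ₛ-assoc b a (invS a))) ⟩
    (b *ₛ a) *ₛ invS a    ≈⟨ *ₛ-congʳ[] (invS a) (≈[]-trans (≈⇒≈[] (*ₛ-comm b a)) ab≈1) ⟩
    oneS *ₛ invS a        ≈⟨ ≈⇒≈[] (*ₛ-identityˡ (invS a)) ⟩
    invS a                ∎
    where open ≈[]-Reasoning N

  invS-unique : ∀ a b → a 0 ≡ + 1 → a *ₛ b ≈ oneS → b ≈ invS a
  invS-unique a b a₀≡1 ab≈1 = ≈[]⇒≈ (λ N → invS-unique[] a b a₀≡1 (≈⇒≈[] ab≈1))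

  invS-cong[] : ∀ {N} a a′ → a′ 0 ≡ + 1 → a ≈[ N ] a′ → invS a ≈[ N ] invS a′
  invS-cong[] a a′ a′₀≡1 a≈a′ = invS-unique[] a′ (invS a) a′₀≡1
    (≈[]-trans (*ₛ-congʳ[] (invS a) (≈[]-sym a≈a′))
               (≈⇒≈[] (invS-inverseʳ a (trans (at≤ a≈a′ 0 z≤n) a′₀≡1))))

  invS-cong : ∀ a a′ → a′ 0 ≡ + 1 → a ≈ a′ → invS a ≈ invS a′
  invS-cong a a′ a′₀≡1 a≈a′ = ≈[]⇒≈ (λ N → invS-cong[] a a′ a′₀≡1 (≈⇒≈[] a≈a′))

  *ₛ-const : ∀ a b → a 0 ≡ + 1 → b 0 ≡ + 1 → (a *ₛ b) 0 ≡ + 1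
  *ₛ-const a b a₀≡1 b₀≡1 = cong₂ _*ᶻ_ a₀≡1 b₀≡1

  invS-*ₛ : ∀ a b → a 0 ≡ + 1 → b 0 ≡ + 1 → invS (a *ₛ b) ≈ invS a *ₛ invS b
  invS-*ₛ a b a₀≡1 b₀≡1 = R.sym (invS-unique (a *ₛ b) (invS a *ₛ invS b) (*ₛ-const a b a₀≡1 b₀≡1) (begin
    (a *ₛ b) *ₛ (invS a *ₛ invS b)  ≈⟨ solve 4 (λ a b x y → (a :* b) :* (x :* y) := (a :* x) :* (b :* y))
                                           R.refl a b (invS a) (invS b) ⟩
    (a *ₛ invS a) *ₛ (b *ₛ invS b)  ≈⟨ *ₛ-cong (invS-inverseʳ a a₀≡1) (invS-inverseʳ b b₀≡1) ⟩
    oneS *ₛ oneS                    ≈⟨ *ₛ-identityˡ oneS ⟩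
    oneS                            ∎))
    where open ≈-Reasoning

  invS-*ₛ-cancelʳ : ∀ a b → a 0 ≡ + 1 → b 0 ≡ + 1 → invS (a *ₛ b) *ₛ b ≈ invS a
  invS-*ₛ-cancelʳ a b a₀≡1 b₀≡1 = begin
    invS (a *ₛ b) *ₛ b        ≈⟨ *ₛ-congʳ b (invS-*ₛ a b a₀≡1 b₀≡1) ⟩
    (invS a *ₛ invS b) *ₛ b   ≈⟨ *ₛ-assoc (invS a) (invS b) b ⟩
    invS a *ₛ (invS b *ₛ b)   ≈⟨ *ₛ-congˡ (invS a) (invS-inverseˡ b b₀≡1) ⟩
    invS a *ₛ oneS            ≈⟨ *ₛ-identityʳ (invS a) ⟩
    invS a                    ∎
    where open ≈-Reasoning

  *ₛ≈⇒≈*ₛ-invS : ∀ a b c → a 0 ≡ + 1 → a *ₛ b ≈ c → b ≈ c *ₛ invS a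
  *ₛ≈⇒≈*ₛ-invS a b c a₀≡1 ab≈c = begin
    b                          ≈⟨ R.sym (*ₛ-identityˡ b) ⟩
    oneS *ₛ b                  ≈⟨ *ₛ-congʳ b (R.sym (invS-inverseˡ a a₀≡1)) ⟩
    (invS a *ₛ a) *ₛ b         ≈⟨ *ₛ-assoc (invS a) a b ⟩
    invS a *ₛ (a *ₛ b)         ≈⟨ *ₛ-congˡ (invS a) ab≈c ⟩
    invS a *ₛ c                ≈⟨ *ₛ-comm (invS a) c ⟩
    c *ₛ invS a                ∎
    where open ≈-Reasoning

  solve-linear : ∀ {K G} x → K ≈ G +ₛ x *ₛ K → (oneS -ₛ x) *ₛ K ≈ G
  solve-linear {K} {G} x K≈G+xK = begin
    (oneS -ₛ x) *ₛ K          ≈⟨ solve 2 (λ x k → (:con (+ 1) :- x) :* k := k :- x :* k) R.refl x K ⟩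
    K -ₛ x *ₛ K               ≈⟨ +ₛ-congʳ (-ₛ (x *ₛ K)) K≈G+xK ⟩
    (G +ₛ x *ₛ K) -ₛ x *ₛ K   ≈⟨ solve 2 (λ g y → (g :+ y) :- y := g) R.refl G (x *ₛ K) ⟩
    G                         ∎
    where open ≈-Reasoning

  invS-oneS : invS oneS ≈ oneS
  invS-oneS = R.sym (invS-unique oneS oneS refl (*ₛ-identityˡ oneS))

  prodₛ : (ℕ → FPS) → ℕ → FPS
  prodₛ f zero    = oneS
  prodₛ f (suc m) = prodₛ f m *ₛ f m

  poch≈prodₛ : ∀ a b m → poch a b m ≈ prodₛ (λ k → oneS -ₛ (a *ₛ powS b k)) m
  poch≈prodₛ a b zero    = R.refl
  poch≈prodₛ a b (suc m) = *ₛ-congʳ (oneS -ₛ (a *ₛ powS b m)) (poch≈prodₛ a b m)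

  prodₛ-cong : ∀ m {f g} → (∀ k → k < m → f k ≈ g k) → prodₛ f m ≈ prodₛ g m
  prodₛ-cong zero    f≈g = R.refl
  prodₛ-cong (suc m) f≈g = *ₛ-cong (prodₛ-cong m (λ k k<m → f≈g k (ℕ.m≤n⇒m≤1+n k<m))) (f≈g m ℕ.≤-refl)

  prodₛ-cong[] : ∀ {N} m {f g} → (∀ k → k < m → f k ≈[ N ] g k) → prodₛ f m ≈[ N ] prodₛ g m
  prodₛ-cong[] zero    f≈g = ≈[]-refl
  prodₛ-cong[] (suc m) f≈g =
    *ₛ-cong[] (prodₛ-cong[] m (λ k k<m → f≈g k (ℕ.m≤n⇒m≤1+n k<m))) (f≈g m ℕ.≤-refl)

  prodₛ-+ : ∀ f m L → prodₛ f (m ℕ.+ L) ≈ prodₛ f m *ₛ prodₛ (λ k → f (m ℕ.+ k)) L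
  prodₛ-+ f m zero    =
    R.trans (mk≈ λ n → cong (λ x → prodₛ f x n) (ℕ.+-identityʳ m)) (R.sym (*ₛ-identityʳ (prodₛ f m)))
  prodₛ-+ f m (suc L) = begin
    prodₛ f (m ℕ.+ suc L)
      ≈⟨ mk≈ (λ n → cong (λ x → prodₛ f x n) (ℕ.+-suc m L)) ⟩
    prodₛ f (m ℕ.+ L) *ₛ f (m ℕ.+ L)
      ≈⟨ *ₛ-congʳ (f (m ℕ.+ L)) (prodₛ-+ f m L) ⟩
    (prodₛ f m *ₛ prodₛ (λ k → f (m ℕ.+ k)) L) *ₛ f (m ℕ.+ L)
      ≈⟨ *ₛ-assoc (prodₛ f m) (prodₛ (λ k → f (m ℕ.+ k)) L) (f (m ℕ.+ L)) ⟩
    prodₛ f m *ₛ prodₛ (λ k → f (m ℕ.+ k)) (suc L) ∎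
    where open ≈-Reasoning

  prodₛ-head : ∀ f L → prodₛ f (suc L) ≈ f 0 *ₛ prodₛ (λ k → f (suc k)) L
  prodₛ-head f L = R.trans (prodₛ-+ f 1 L) (*ₛ-congʳ (prodₛ (λ k → f (suc k)) L) (*ₛ-identityˡ (f 0)))

  prodₛ-*ₛ : ∀ f g m → prodₛ (λ k → f k *ₛ g k) m ≈ prodₛ f m *ₛ prodₛ g m
  prodₛ-*ₛ f g zero    = R.sym (*ₛ-identityˡ oneS)
  prodₛ-*ₛ f g (suc m) = R.trans (*ₛ-congʳ (f m *ₛ g m) (prodₛ-*ₛ f g m))
    (solve 4 (λ a b c d → (a :* b) :* (c :* d) := (a :* c) :* (b :* d)) R.refl (prodₛ f m) (prodₛ g m) (f m) (g m))

  prodₛ-const : ∀ f m → (∀ k → f k 0 ≡ + 1) → prodₛ f m 0 ≡ + 1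
  prodₛ-const f zero    f₀≡1 = refl
  prodₛ-const f (suc m) f₀≡1 = *ₛ-const (prodₛ f m) (f m) (prodₛ-const f m f₀≡1) (f₀≡1 m)

  prodₛ-extend : ∀ {N} f L M → L ≤ M → (∀ k → L ≤ k → f k ≈[ N ] oneS) → prodₛ f M ≈[ N ] prodₛ f L
  prodₛ-extend {N} f L M L≤M f≈1 = begin
    prodₛ f M
      ≈⟨ ≈⇒≈[] (mk≈ λ n → cong (λ x → prodₛ f x n) (sym (ℕ.m+[n∸m]≡n L≤M))) ⟩
    prodₛ f (L ℕ.+ (M ∸ L))
      ≈⟨ ≈⇒≈[] (prodₛ-+ f L (M ∸ L)) ⟩
    prodₛ f L *ₛ prodₛ (λ k → f (L ℕ.+ k)) (M ∸ L)
      ≈⟨ *ₛ-congˡ[] (prodₛ f L) (prodₛ-cong[] (M ∸ L) (λ k _ → f≈1 (L ℕ.+ k) (ℕ.m≤m+n L k))) ⟩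
    prodₛ f L *ₛ prodₛ (λ _ → oneS) (M ∸ L)
      ≈⟨ ≈⇒≈[] (*ₛ-congˡ (prodₛ f L) (prod-ones (M ∸ L))) ⟩
    prodₛ f L *ₛ oneS
      ≈⟨ ≈⇒≈[] (*ₛ-identityʳ (prodₛ f L)) ⟩
    prodₛ f L ∎
    where
    open ≈[]-Reasoning N
    prod-ones : ∀ m → prodₛ (λ _ → oneS) m ≈ oneS
    prod-ones zero    = R.refl
    prod-ones (suc m) = R.trans (*ₛ-identityʳ _) (prod-ones m)

  invS-prodₛ-suc : ∀ f k → (∀ j → f j 0 ≡ + 1) → invS (prodₛ f (suc k)) *ₛ f k ≈ invS (prodₛ f k)
  invS-prodₛ-suc f k f₀≡1 = invS-*ₛ-cancelʳ (prodₛ f k) (f k) (prodₛ-const f k f₀≡1) (f₀≡1 k)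

module QSeries where

  open import Defs
  open PowerSeries
  open import Data.Nat using (ℕ; zero; suc; _+_; _*_; _∸_; _≤_; _<_; z≤n; s≤s)
  import Data.Nat.Properties as ℕ
  open import Data.Nat.Tactic.RingSolver using (solve-∀)
  open import Data.Integer as ℤ using (+_)
  import Data.Integer.Properties as ℤ
  open import Relation.Binary.PropositionalEquality

  1-q^_ 1+q^_ : ℕ → FPS
  1-q^ a = oneS -ₛ mono a
  1+q^ a = oneS +ₛ mono a

  qPoch q²Poch -q²Poch q⁴Poch : ℕ → FPS
  qPoch   = prodₛ (λ k → 1-q^ suc k)
  q²Poch  = prodₛ (λ k → 1-q^ (2 + k * 2))
  -q²Poch = prodₛ (λ k → 1+q^ (2 + k * 2))
  q⁴Poch  = prodₛ (λ k → 1-q^ (4 + k * 4))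

  -q²PochFrom : ℕ → ℕ → FPS
  -q²PochFrom m = prodₛ (λ k → 1+q^ (2 + (m + k) * 2))

  1/qPoch 1/q²Poch : ℕ → FPS
  1/qPoch k  = invS (qPoch k)
  1/q²Poch k = invS (q²Poch k)

  qPoch-const : ∀ m → qPoch m 0 ≡ + 1
  qPoch-const m = prodₛ-const _ m (λ _ → refl)

  q²Poch-const : ∀ m → q²Poch m 0 ≡ + 1
  q²Poch-const m = prodₛ-const _ m (λ _ → refl)

  -q²Poch-const : ∀ m → -q²Poch m 0 ≡ + 1
  -q²Poch-const m = prodₛ-const _ m (λ _ → refl)

  1/qPoch-suc : ∀ k → 1/qPoch (suc k) *ₛ 1-q^ suc k ≈ 1/qPoch k
  1/qPoch-suc k = invS-prodₛ-suc _ k (λ _ → refl)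

  1/q²Poch-suc : ∀ k → 1/q²Poch (suc k) *ₛ 1-q^ (2 + k * 2) ≈ 1/q²Poch k
  1/q²Poch-suc k = invS-prodₛ-suc _ k (λ _ → refl)

  mono-*ₛ-powS : ∀ a k → mono a *ₛ powS (mono a) k ≈ mono (a + k * a)
  mono-*ₛ-powS a k = R.trans (*ₛ-congˡ (mono a) (powS-mono a k)) (mono-+ a (k * a))

  poch-q^≈prodₛ : ∀ a m → poch (mono a) (mono a) m ≈ prodₛ (λ k → 1-q^ (a + k * a)) m
  poch-q^≈prodₛ a m = R.trans (poch≈prodₛ (mono a) (mono a) m)
    (prodₛ-cong m (λ k _ → +ₛ-congˡ oneS (R.-‿cong (mono-*ₛ-powS a k))))

  poch-q≈qPoch : ∀ m → poch (mono 1) (mono 1) m ≈ qPoch m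
  poch-q≈qPoch m = R.trans (poch-q^≈prodₛ 1 m)
    (prodₛ-cong m (λ k _ → +ₛ-congˡ oneS (R.-‿cong (mono-≡ (cong suc (ℕ.*-identityʳ k))))))

  poch-q⁴≈q⁴Poch : ∀ m → poch (mono 4) (mono 4) m ≈ q⁴Poch m
  poch-q⁴≈q⁴Poch = poch-q^≈prodₛ 4

  poch--q²≈-q²Poch : ∀ m → poch (-ₛ mono 2) (mono 2) m ≈ -q²Poch m
  poch--q²≈-q²Poch m = R.trans (poch≈prodₛ (-ₛ mono 2) (mono 2) m) (prodₛ-cong m (λ k _ → begin
    oneS -ₛ (-ₛ mono 2) *ₛ powS (mono 2) k
      ≈⟨ solve 2 (λ x y → :con (+ 1) :- (:- x) :* y := :con (+ 1) :+ x :* y)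
              R.refl (mono 2) (powS (mono 2) k) ⟩
    oneS +ₛ mono 2 *ₛ powS (mono 2) k
      ≈⟨ +ₛ-congˡ oneS (mono-*ₛ-powS 2 k) ⟩
    1+q^ (2 + k * 2) ∎))
    where open ≈-Reasoning

  q⁴Poch≈q²Poch*-q²Poch : ∀ m → q⁴Poch m ≈ q²Poch m *ₛ -q²Poch m
  q⁴Poch≈q²Poch*-q²Poch m = R.trans (prodₛ-cong m (λ k _ → difference-of-squares k)) (prodₛ-*ₛ _ _ m)
    where
    difference-of-squares : ∀ k → 1-q^ (4 + k * 4) ≈ 1-q^ (2 + k * 2) *ₛ 1+q^ (2 + k * 2)
    difference-of-squares k = R.sym (R.trans
      (solve 1 (λ x → (:con (+ 1) :- x) :* (:con (+ 1) :+ x) := :con (+ 1) :- x :* x) R.refl (mono (2 + k * 2)))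
      (+ₛ-congˡ oneS (R.-‿cong (R.trans (mono-+ (2 + k * 2) (2 + k * 2)) (mono-≡ (exponent k))))))
      where
      exponent : ∀ k → (2 + k * 2) + (2 + k * 2) ≡ 4 + k * 4
      exponent = solve-∀

  mono-*ₛ-split : ∀ a b I I′ → I *ₛ 1-q^ b ≈ I′ →
    mono a *ₛ I ≈ mono (a + b) *ₛ I +ₛ mono a *ₛ I′
  mono-*ₛ-split a b I I′ I*[1-q^b]≈I′ = begin
    mono a *ₛ I
      ≈⟨ solve 3 (λ A x y → A :* y := A :* (x :* y) :+ A :* (y :* (:con (+ 1) :- x)))
              R.refl (mono a) (mono b) I ⟩
    mono a *ₛ (mono b *ₛ I) +ₛ mono a *ₛ (I *ₛ 1-q^ b)
      ≈⟨ R.+-cong (mono-+-*ₛ a b I) (*ₛ-congˡ (mono a) I*[1-q^b]≈I′) ⟩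
    mono (a + b) *ₛ I +ₛ mono a *ₛ I′ ∎
    where open ≈-Reasoning

  -- Partial sums of Euler's expansion (-q^(2m+2);q²)_∞ = Σ_k q^(k²+k+2mk) / (q²;q²)_k.
  eulerExp : ℕ → ℕ → ℕ
  eulerExp m k = k * k + k + k * m * 2

  eulerTerm : ℕ → ℕ → FPS
  eulerTerm m k = mono (eulerExp m k) *ₛ 1/q²Poch k

  eulerSum : ℕ → ℕ → FPS
  eulerSum M m = sumₛ M (eulerTerm m)

  eulerTerm-q^∣ : ∀ m k → q^ k ∣ eulerTerm m k
  eulerTerm-q^∣ m k = q^∣-weaken k≤exp (q^∣mono-*ₛ (eulerExp m k) (1/q²Poch k))
    where k≤exp = ℕ.≤-trans (ℕ.m≤n+m k (k * k)) (ℕ.m≤m+n (k * k + k) (k * m * 2))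

  eulerTerm-step : ∀ m k →
    eulerTerm m (suc k) ≈ eulerTerm (suc m) (suc k) +ₛ mono (2 + m * 2) *ₛ eulerTerm (suc m) k
  eulerTerm-step m k = begin
    mono a *ₛ 1/q²Poch (suc k)
      ≈⟨ mono-*ₛ-split a (2 + k * 2) (1/q²Poch (suc k)) (1/q²Poch k) (1/q²Poch-suc k) ⟩
    mono (a + (2 + k * 2)) *ₛ 1/q²Poch (suc k) +ₛ mono a *ₛ 1/q²Poch k
      ≈⟨ R.+-cong (*ₛ-congʳ (1/q²Poch (suc k)) (mono-≡ (shift-k k m)))
                  (R.trans (*ₛ-congʳ (1/q²Poch k) (mono-≡ (shift-m k m)))
                           (R.sym (mono-+-*ₛ (2 + m * 2) _ (1/q²Poch k)))) ⟩
    eulerTerm (suc m) (suc k) +ₛ mono (2 + m * 2) *ₛ eulerTerm (suc m) k ∎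
    where
    open ≈-Reasoning
    a = eulerExp m (suc k)
    shift-k : ∀ k m → (suc k * suc k + suc k + suc k * m * 2) + (2 + k * 2)
                    ≡ suc k * suc k + suc k + suc k * suc m * 2
    shift-k = solve-∀
    shift-m : ∀ k m → suc k * suc k + suc k + suc k * m * 2 ≡ (2 + m * 2) + (k * k + k + k * suc m * 2)
    shift-m = solve-∀

  eulerTerm-zero : ∀ m → eulerTerm m 0 ≈ oneS
  eulerTerm-zero m = R.trans (*ₛ-cong mono-zero invS-oneS) (*ₛ-identityˡ oneS)

  eulerSum-recurrence[] : ∀ N m →
    eulerSum N m ≈[ N ] eulerSum N (suc m) +ₛ mono (2 + m * 2) *ₛ eulerSum N (suc m)
  eulerSum-recurrence[] N m =
    sumₛ-recurrence[] N (mono (2 + m * 2)) (eulerTerm m) (eulerTerm (suc m)) (eulerTerm (suc m))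
      (eulerTerm-q^∣ m) (eulerTerm-q^∣ (suc m)) R.refl (eulerTerm-step m)

  eulerSum-small[] : ∀ N m → N < 2 + m * 2 → eulerSum N m ≈[ N ] oneS
  eulerSum-small[] N m N<2+2m =
    ≈[]-trans (sumₛ-extend 0 N (eulerTerm m) z≤n higher) (≈⇒≈[] (eulerTerm-zero m))
    where
    exponent : ∀ k m → suc k * suc k + suc k + suc k * m * 2 ≡ (2 + m * 2) + (k * k + 3 * k + k * m * 2)
    exponent = solve-∀
    higher : ∀ k → 0 < k → q^ suc N ∣ eulerTerm m k
    higher (suc k) _ = q^∣-weaken
      (ℕ.≤-trans N<2+2m (ℕ.≤-trans (ℕ.m≤m+n (2 + m * 2) _) (ℕ.≤-reflexive (sym (exponent k m)))))
      (q^∣mono-*ₛ (eulerExp m (suc k)) (1/q²Poch (suc k)))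

  -q²PochFrom-head : ∀ m L → -q²PochFrom m (suc L) ≈ 1+q^ (2 + m * 2) *ₛ -q²PochFrom (suc m) L
  -q²PochFrom-head m L = R.trans (prodₛ-head _ L)
    (*ₛ-cong (factor-≡ (ℕ.+-identityʳ m)) (prodₛ-cong L (λ k _ → factor-≡ (ℕ.+-suc m k))))
    where
    factor-≡ : ∀ {a b} → a ≡ b → 1+q^ (2 + a * 2) ≈ 1+q^ (2 + b * 2)
    factor-≡ refl = R.refl

  -q²PochFrom≈[]eulerSum : ∀ N L m → N < 2 + (m + L) * 2 → -q²PochFrom m L ≈[ N ] eulerSum N m
  -q²PochFrom≈[]eulerSum N zero    m N<bound =
    ≈[]-sym (eulerSum-small[] N m (subst (λ x → N < 2 + x * 2) (ℕ.+-identityʳ m) N<bound))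
  -q²PochFrom≈[]eulerSum N (suc L) m N<bound = begin
    -q²PochFrom m (suc L)
      ≈⟨ ≈⇒≈[] (-q²PochFrom-head m L) ⟩
    1+q^ (2 + m * 2) *ₛ -q²PochFrom (suc m) L
      ≈⟨ *ₛ-congˡ[] (1+q^ (2 + m * 2))
          (-q²PochFrom≈[]eulerSum N L (suc m) (subst (λ x → N < 2 + x * 2) (ℕ.+-suc m L) N<bound)) ⟩
    1+q^ (2 + m * 2) *ₛ eulerSum N (suc m)
      ≈⟨ ≈⇒≈[] (solve 2 (λ x e → (:con (+ 1) :+ x) :* e := e :+ x :* e)
                     R.refl (mono (2 + m * 2)) (eulerSum N (suc m))) ⟩
    eulerSum N (suc m) +ₛ mono (2 + m * 2) *ₛ eulerSum N (suc m)
      ≈⟨ ≈[]-sym (eulerSum-recurrence[] N m) ⟩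
    eulerSum N m ∎
    where open ≈[]-Reasoning N

  convolutionTerm : ℕ → ℕ → FPS
  convolutionTerm s i = mono (s ∸ i) *ₛ (1/q²Poch i *ₛ 1/q²Poch (s ∸ i))

  evenConvolution : ℕ → FPS
  evenConvolution s = sumₛ s (convolutionTerm s)

  convolutionTerm-reflect : ∀ s i → i ≤ s →
    mono s *ₛ convolutionTerm s (s ∸ i) ≈ mono (2 * i) *ₛ convolutionTerm s i
  convolutionTerm-reflect s i i≤s = begin
    mono s *ₛ (mono (s ∸ (s ∸ i)) *ₛ (1/q²Poch (s ∸ i) *ₛ 1/q²Poch (s ∸ (s ∸ i))))
      ≈⟨ *ₛ-congˡ (mono s) (*ₛ-cong (mono-≡ s∸[s∸i]≡i)
           (R.trans (*ₛ-congˡ (1/q²Poch (s ∸ i)) (1/q²Poch-≡ s∸[s∸i]≡i))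
                    (*ₛ-comm (1/q²Poch (s ∸ i)) (1/q²Poch i)))) ⟩
    mono s *ₛ (mono i *ₛ W)           ≈⟨ mono-+-*ₛ s i W ⟩
    mono (s + i) *ₛ W                 ≈⟨ *ₛ-congʳ W (mono-≡ exponent) ⟩
    mono (2 * i + (s ∸ i)) *ₛ W       ≈⟨ R.sym (mono-+-*ₛ (2 * i) (s ∸ i) W) ⟩
    mono (2 * i) *ₛ convolutionTerm s i ∎
    where
    open ≈-Reasoning
    W = 1/q²Poch i *ₛ 1/q²Poch (s ∸ i)
    s∸[s∸i]≡i = ℕ.m∸[m∸n]≡n i≤s
    1/q²Poch-≡ : ∀ {a b} → a ≡ b → 1/q²Poch a ≈ 1/q²Poch b
    1/q²Poch-≡ refl = R.refl
    arrange : ∀ d i → d + i + i ≡ 2 * i + d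
    arrange = solve-∀
    exponent : s + i ≡ 2 * i + (s ∸ i)
    exponent = trans (cong (_+ i) (sym (ℕ.m∸n+n≡m i≤s))) (arrange (s ∸ i) i)

  convolutionTerm-lower : ∀ s j →
    convolutionTerm (suc s) (suc j) -ₛ mono (2 * suc j) *ₛ convolutionTerm (suc s) (suc j) ≈ convolutionTerm s j
  convolutionTerm-lower s j = begin
    convolutionTerm (suc s) (suc j) -ₛ mono (2 * suc j) *ₛ convolutionTerm (suc s) (suc j)
      ≈⟨ solve 4 (λ A x y z → A :* (y :* z) :- x :* (A :* (y :* z)) := A :* ((y :* (:con (+ 1) :- x)) :* z))
                 R.refl (mono (s ∸ j)) (mono (2 * suc j)) (1/q²Poch (suc j)) (1/q²Poch (s ∸ j)) ⟩
    mono (s ∸ j) *ₛ ((1/q²Poch (suc j) *ₛ 1-q^ (2 * suc j)) *ₛ 1/q²Poch (s ∸ j))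
      ≈⟨ *ₛ-congˡ (mono (s ∸ j)) (*ₛ-congʳ (1/q²Poch (s ∸ j)) (R.trans
           (*ₛ-congˡ (1/q²Poch (suc j)) (+ₛ-congˡ oneS (R.-‿cong (mono-≡ (double-suc j)))))
           (1/q²Poch-suc j))) ⟩
    convolutionTerm s j ∎
    where
    open ≈-Reasoning
    double-suc : ∀ j → 2 * suc j ≡ 2 + j * 2
    double-suc = solve-∀

  -- Multiplying by 1 - q^(s+1) and reversing the summation in the subtracted copy
  -- leaves the factors 1 - q^(2i), which lower the index i.
  evenConvolution-step : ∀ s → 1-q^ suc s *ₛ evenConvolution (suc s) ≈ evenConvolution s
  evenConvolution-step s = begin
    1-q^ suc s *ₛ C
      ≈⟨ solve 2 (λ x c → (:con (+ 1) :- x) :* c := c :- x :* c) R.refl (mono (suc s)) C ⟩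
    C -ₛ mono (suc s) *ₛ C
      ≈⟨ +ₛ-congˡ C (R.-‿cong (R.trans (sumₛ-*ˡ (suc s) (mono (suc s)) term)
           (R.trans (sumₛ-reverse (suc s) _) (sumₛ-cong (suc s) (convolutionTerm-reflect (suc s)))))) ⟩
    sumₛ (suc s) term -ₛ sumₛ (suc s) (λ i → mono (2 * i) *ₛ term i)
      ≈⟨ R.sym (sumₛ--ₛ (suc s) _ _) ⟩
    sumₛ (suc s) (λ i → term i -ₛ mono (2 * i) *ₛ term i)
      ≈⟨ sumₛ-head s _ ⟩
    (term 0 -ₛ mono 0 *ₛ term 0) +ₛ sumₛ s (λ j → term (suc j) -ₛ mono (2 * suc j) *ₛ term (suc j))
      ≈⟨ R.+-cong first-vanishes (sumₛ-cong s (λ j _ → convolutionTerm-lower s j)) ⟩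
    zeroS +ₛ evenConvolution s
      ≈⟨ R.+-identityˡ (evenConvolution s) ⟩
    evenConvolution s ∎
    where
    open ≈-Reasoning
    C = evenConvolution (suc s)
    term = convolutionTerm (suc s)
    first-vanishes : term 0 -ₛ mono 0 *ₛ term 0 ≈ zeroS
    first-vanishes = R.trans
      (+ₛ-congˡ (term 0) (R.-‿cong (R.trans (*ₛ-congʳ (term 0) mono-zero) (*ₛ-identityˡ (term 0)))))
      (R.-‿inverseʳ (term 0))

  qPoch-*ₛ-evenConvolution : ∀ s → qPoch s *ₛ evenConvolution s ≈ oneS
  qPoch-*ₛ-evenConvolution zero    = R.trans (*ₛ-identityˡ _)
    (R.trans (*ₛ-cong mono-zero (*ₛ-cong invS-oneS invS-oneS)) (R.trans (*ₛ-identityˡ _) (*ₛ-identityˡ oneS)))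
  qPoch-*ₛ-evenConvolution (suc s) = R.trans (*ₛ-assoc (qPoch s) (1-q^ suc s) (evenConvolution (suc s)))
    (R.trans (*ₛ-congˡ (qPoch s) (evenConvolution-step s)) (qPoch-*ₛ-evenConvolution s))

  evenConvolution≈1/qPoch : ∀ s → evenConvolution s ≈ 1/qPoch s
  evenConvolution≈1/qPoch s =
    invS-unique (qPoch s) (evenConvolution s) (qPoch-const s) (qPoch-*ₛ-evenConvolution s)

  n≤n*n : ∀ n → n ≤ n * n
  n≤n*n zero    = z≤n
  n≤n*n (suc n) = ℕ.m≤m*n (suc n) (suc n)

  rogersRamanujanTerm : ℕ → ℕ → FPS
  rogersRamanujanTerm j m = mono (m * j + m * m) *ₛ 1/qPoch m

  rogersRamanujanSum : ℕ → ℕ → FPS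
  rogersRamanujanSum M j = sumₛ M (rogersRamanujanTerm j)

  doubleTerm : ℕ → ℕ → FPS
  doubleTerm n k = (mono (n * n) *ₛ 1/q²Poch n) *ₛ eulerTerm n k

  -- The exponent n² + k² + k + 2nk of doubleTerm n k is (n+k)² + k.
  doubleTerm-diagonal : ∀ i s → i ≤ s →
    doubleTerm i (s ∸ i) ≈ mono (s * 0 + s * s) *ₛ (mono (s ∸ i) *ₛ (1/q²Poch i *ₛ 1/q²Poch (s ∸ i)))
  doubleTerm-diagonal i s i≤s = begin
    (mono (i * i) *ₛ 1/q²Poch i) *ₛ (mono (eulerExp i k) *ₛ 1/q²Poch k)
      ≈⟨ solve 4 (λ a b c d → (a :* b) :* (c :* d) := (a :* c) :* (b :* d))
                 R.refl (mono (i * i)) (1/q²Poch i) (mono (eulerExp i k)) (1/q²Poch k) ⟩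
    (mono (i * i) *ₛ mono (eulerExp i k)) *ₛ (1/q²Poch i *ₛ 1/q²Poch k)
      ≈⟨ *ₛ-congʳ (1/q²Poch i *ₛ 1/q²Poch k) (R.trans (mono-+ (i * i) (eulerExp i k))
           (mono-≡ (trans (exponent i k) (cong (λ x → x * 0 + x * x + k) (ℕ.m+[n∸m]≡n i≤s))))) ⟩
    mono (s * 0 + s * s + k) *ₛ (1/q²Poch i *ₛ 1/q²Poch k)
      ≈⟨ R.sym (mono-+-*ₛ (s * 0 + s * s) k (1/q²Poch i *ₛ 1/q²Poch k)) ⟩
    mono (s * 0 + s * s) *ₛ (mono k *ₛ (1/q²Poch i *ₛ 1/q²Poch k)) ∎
    where
    open ≈-Reasoning
    k = s ∸ i
    exponent : ∀ i k → i * i + (k * k + k + k * i * 2) ≡ (i + k) * 0 + (i + k) * (i + k) + k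
    exponent = solve-∀

  doubleSum≈[]rogersRamanujanSum : ∀ N →
    sumₛ N (λ n → (mono (n * n) *ₛ 1/q²Poch n) *ₛ eulerSum N n) ≈[ N ] rogersRamanujanSum N 0
  doubleSum≈[]rogersRamanujanSum N = begin
    sumₛ N (λ n → (mono (n * n) *ₛ 1/q²Poch n) *ₛ eulerSum N n)
      ≈⟨ ≈⇒≈[] (sumₛ-cong N (λ n _ → sumₛ-*ˡ N (mono (n * n) *ₛ 1/q²Poch n) (eulerTerm n))) ⟩
    sumₛ N (λ n → sumₛ N (doubleTerm n))
      ≈⟨ sumₛ-cong[] N (λ n n≤N →
           sumₛ-extend (N ∸ n) N (doubleTerm n) (ℕ.m∸n≤m N n) (beyond-diagonal n n≤N)) ⟩
    sumₛ N (λ n → sumₛ (N ∸ n) (doubleTerm n))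
      ≈⟨ ≈⇒≈[] (sumₛ-cong N (λ i _ →
           sumₛ-cong (N ∸ i) (λ j _ → doubleTerm-≡ i (sym (ℕ.m+n∸m≡n i j))))) ⟩
    sumₛ N (λ i → sumₛ (N ∸ i) (λ j → doubleTerm i ((i + j) ∸ i)))
      ≈⟨ ≈⇒≈[] (R.sym (sumₛ-triangle N (λ i s → doubleTerm i (s ∸ i)))) ⟩
    sumₛ N (λ s → sumₛ s (λ i → doubleTerm i (s ∸ i)))
      ≈⟨ ≈⇒≈[] (sumₛ-cong N (λ s _ → R.trans (sumₛ-cong s (λ i i≤s → doubleTerm-diagonal i s i≤s))
                                             (R.sym (sumₛ-*ˡ s (mono (s * 0 + s * s)) (convolutionTerm s))))) ⟩
    sumₛ N (λ s → mono (s * 0 + s * s) *ₛ evenConvolution s)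
      ≈⟨ ≈⇒≈[] (sumₛ-cong N (λ s _ → *ₛ-congˡ (mono (s * 0 + s * s)) (evenConvolution≈1/qPoch s))) ⟩
    rogersRamanujanSum N 0 ∎
    where
    open ≈[]-Reasoning N
    doubleTerm-≡ : ∀ n {a b} → a ≡ b → doubleTerm n a ≈ doubleTerm n b
    doubleTerm-≡ n refl = R.refl
    beyond-diagonal : ∀ n → n ≤ N → ∀ k → N ∸ n < k → q^ suc N ∣ doubleTerm n k
    beyond-diagonal n n≤N k N∸n<k = q^∣-weaken N<exp
      (q^∣-*ₛ (q^∣mono-*ₛ (n * n) (1/q²Poch n)) (q^∣mono-*ₛ (eulerExp n k) (1/q²Poch k)))
      where
      N<exp : suc N ≤ n * n + eulerExp n k
      N<exp = ℕ.≤-trans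
        (subst (_≤ n + k) (trans (ℕ.+-suc n (N ∸ n)) (cong suc (ℕ.m+[n∸m]≡n n≤N))) (ℕ.+-monoʳ-≤ n N∸n<k))
        (ℕ.+-mono-≤ (n≤n*n n) (ℕ.≤-trans (ℕ.m≤n+m k (k * k)) (ℕ.m≤m+n (k * k + k) (k * n * 2))))

  rhsTerm : ℕ → FPS
  rhsTerm m = mono (m * m) *ₛ invS (poch (mono 4) (mono 4) m)

  rhsTerm-*ₛ--q²Poch : ∀ N n → n ≤ suc N →
    rhsTerm n *ₛ -q²Poch (suc N) ≈ (mono (n * n) *ₛ 1/q²Poch n) *ₛ -q²PochFrom n (suc N ∸ n)
  rhsTerm-*ₛ--q²Poch N n n≤1+N = begin
    rhsTerm n *ₛ -q²Poch (suc N)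
      ≈⟨ *ₛ-cong (*ₛ-congˡ (mono (n * n)) (invS-cong (poch (mono 4) (mono 4) n) (q²Poch n *ₛ -q²Poch n)
                     (*ₛ-const (q²Poch n) (-q²Poch n) (q²Poch-const n) (-q²Poch-const n))
                     (R.trans (poch-q⁴≈q⁴Poch n) (q⁴Poch≈q²Poch*-q²Poch n))))
                 (R.trans (mk≈ λ x → cong (λ y → -q²Poch y x) (sym (ℕ.m+[n∸m]≡n n≤1+N)))
                          (prodₛ-+ _ n (suc N ∸ n))) ⟩
    (mono (n * n) *ₛ I) *ₛ (-q²Poch n *ₛ T)
      ≈⟨ solve 4 (λ a i p t → (a :* i) :* (p :* t) := (a :* (i :* p)) :* t)
                 R.refl (mono (n * n)) I (-q²Poch n) T ⟩
    (mono (n * n) *ₛ (I *ₛ -q²Poch n)) *ₛ T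
      ≈⟨ *ₛ-congʳ T (*ₛ-congˡ (mono (n * n))
           (invS-*ₛ-cancelʳ (q²Poch n) (-q²Poch n) (q²Poch-const n) (-q²Poch-const n))) ⟩
    (mono (n * n) *ₛ 1/q²Poch n) *ₛ T ∎
    where
    open ≈-Reasoning
    I = invS (q²Poch n *ₛ -q²Poch n)
    T = -q²PochFrom n (suc N ∸ n)

  rhsSum-*ₛ--q²Poch≈[]rogersRamanujanSum : ∀ N →
    sumₛ N rhsTerm *ₛ -q²Poch (suc N) ≈[ N ] rogersRamanujanSum N 0
  rhsSum-*ₛ--q²Poch≈[]rogersRamanujanSum N = begin
    sumₛ N rhsTerm *ₛ -q²Poch (suc N)
      ≈⟨ ≈⇒≈[] (sumₛ-*ʳ N (-q²Poch (suc N)) rhsTerm) ⟩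
    sumₛ N (λ n → rhsTerm n *ₛ -q²Poch (suc N))
      ≈⟨ ≈⇒≈[] (sumₛ-cong N (λ n n≤N → rhsTerm-*ₛ--q²Poch N n (ℕ.m≤n⇒m≤1+n n≤N))) ⟩
    sumₛ N (λ n → (mono (n * n) *ₛ 1/q²Poch n) *ₛ -q²PochFrom n (suc N ∸ n))
      ≈⟨ sumₛ-cong[] N (λ n n≤N →
           *ₛ-congˡ[] (mono (n * n) *ₛ 1/q²Poch n)
             (-q²PochFrom≈[]eulerSum N (suc N ∸ n) n (long-enough n n≤N))) ⟩
    sumₛ N (λ n → (mono (n * n) *ₛ 1/q²Poch n) *ₛ eulerSum N n)
      ≈⟨ doubleSum≈[]rogersRamanujanSum N ⟩
    rogersRamanujanSum N 0 ∎
    where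
    open ≈[]-Reasoning N
    long-enough : ∀ n → n ≤ N → N < 2 + (n + (suc N ∸ n)) * 2
    long-enough n n≤N = subst (λ x → N < 2 + x * 2) (sym (ℕ.m+[n∸m]≡n (ℕ.m≤n⇒m≤1+n n≤N)))
      (ℕ.≤-trans (ℕ.m≤m*n (suc N) 2) (ℕ.m≤n+m (suc N * 2) 2))

  rogersRamanujanTerm-q^∣ : ∀ j m → q^ m ∣ rogersRamanujanTerm j m
  rogersRamanujanTerm-q^∣ j m =
    q^∣-weaken (ℕ.≤-trans (n≤n*n m) (ℕ.m≤n+m (m * m) (m * j))) (q^∣mono-*ₛ (m * j + m * m) (1/qPoch m))

  rogersRamanujanTerm-zero : ∀ j → rogersRamanujanTerm j 0 ≈ oneS
  rogersRamanujanTerm-zero j = R.trans (*ₛ-cong mono-zero invS-oneS) (*ₛ-identityˡ oneS)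

  rogersRamanujanTerm-step : ∀ j m → rogersRamanujanTerm j (suc m) ≈
    rogersRamanujanTerm (suc j) (suc m) +ₛ mono (suc j) *ₛ rogersRamanujanTerm (suc (suc j)) m
  rogersRamanujanTerm-step j m = begin
    mono a *ₛ 1/qPoch (suc m)
      ≈⟨ mono-*ₛ-split a (suc m) (1/qPoch (suc m)) (1/qPoch m) (1/qPoch-suc m) ⟩
    mono (a + suc m) *ₛ 1/qPoch (suc m) +ₛ mono a *ₛ 1/qPoch m
      ≈⟨ R.+-cong (*ₛ-congʳ (1/qPoch (suc m)) (mono-≡ (shift-j j m)))
                  (R.trans (*ₛ-congʳ (1/qPoch m) (mono-≡ (shift-m j m)))
                           (R.sym (mono-+-*ₛ (suc j) _ (1/qPoch m)))) ⟩
    rogersRamanujanTerm (suc j) (suc m) +ₛ mono (suc j) *ₛ rogersRamanujanTerm (suc (suc j)) m ∎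
    where
    open ≈-Reasoning
    a = suc m * j + suc m * suc m
    shift-j : ∀ j m → (suc m * j + suc m * suc m) + suc m ≡ suc m * suc j + suc m * suc m
    shift-j = solve-∀
    shift-m : ∀ j m → suc m * j + suc m * suc m ≡ suc j + (m * suc (suc j) + m * m)
    shift-m = solve-∀

  rogersRamanujanSum-recurrence[] : ∀ N j → rogersRamanujanSum N j ≈[ N ]
    rogersRamanujanSum N (suc j) +ₛ mono (suc j) *ₛ rogersRamanujanSum N (suc (suc j))
  rogersRamanujanSum-recurrence[] N j = sumₛ-recurrence[] N (mono (suc j))
    (rogersRamanujanTerm j) (rogersRamanujanTerm (suc j)) (rogersRamanujanTerm (suc (suc j)))
    (rogersRamanujanTerm-q^∣ j) (rogersRamanujanTerm-q^∣ (suc j)) R.refl (rogersRamanujanTerm-step j)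

  rogersRamanujanSum-small[] : ∀ N j → N ≤ j → rogersRamanujanSum N j ≈[ N ] oneS
  rogersRamanujanSum-small[] N j N≤j =
    ≈[]-trans (sumₛ-extend 0 N (rogersRamanujanTerm j) z≤n higher) (≈⇒≈[] (rogersRamanujanTerm-zero j))
    where
    higher : ∀ m → 0 < m → q^ suc N ∣ rogersRamanujanTerm j m
    higher (suc m) _ =
      q^∣-weaken (ℕ.≤-trans (s≤s N≤j) j<exp) (q^∣mono-*ₛ (suc m * j + suc m * suc m) (1/qPoch (suc m)))
      where
      j<exp : suc j ≤ suc m * j + suc m * suc m
      j<exp = subst (_≤ suc m * j + suc m * suc m) (ℕ.+-comm j 1) (ℕ.+-mono-≤ (ℕ.m≤m+n j (m * j)) (s≤s z≤n))

  -- The generating function of the subsets of {j+1, …, j+L} without two consecutive elements,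
  -- split according to whether the largest element j+L is taken.
  fib : ℕ → ℕ → FPS
  fib j zero          = oneS
  fib j (suc zero)    = oneS +ₛ mono (suc j)
  fib j (suc (suc L)) = fib j (suc L) +ₛ mono (j + suc (suc L)) *ₛ fib j L

  -- The same split according to whether the smallest element j+1 is taken.
  fib-recurrenceˡ : ∀ j L → fib j (suc (suc L)) ≈ fib (suc j) (suc L) +ₛ mono (suc j) *ₛ fib (suc (suc j)) L
  fib-recurrenceˡ j zero = R.trans (+ₛ-congˡ (oneS +ₛ mono (suc j)) (*ₛ-congʳ oneS (mono-≡ (ℕ.+-comm j 2))))
    (solve 2 (λ a b → (:con (+ 1) :+ a) :+ b :* :con (+ 1) := (:con (+ 1) :+ b) :+ a :* :con (+ 1)) R.refl
       (mono (suc j)) (mono (suc (suc j))))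
  fib-recurrenceˡ j (suc zero) = begin
    (oneS +ₛ mono (suc j) +ₛ mono (j + 2) *ₛ oneS) +ₛ mono (j + 3) *ₛ (oneS +ₛ mono (suc j))
      ≈⟨ R.+-cong (+ₛ-congˡ (oneS +ₛ mono (suc j)) (*ₛ-congʳ oneS (mono-≡ (ℕ.+-comm j 2))))
                  (*ₛ-congʳ (oneS +ₛ mono (suc j)) (mono-≡ (ℕ.+-comm j 3))) ⟩
    (oneS +ₛ a +ₛ b *ₛ oneS) +ₛ c *ₛ (oneS +ₛ a)
      ≈⟨ solve 3 (λ a b c → ((:con (+ 1) :+ a) :+ b :* :con (+ 1)) :+ c :* (:con (+ 1) :+ a)
                            := ((:con (+ 1) :+ b) :+ c :* :con (+ 1)) :+ a :* (:con (+ 1) :+ c)) R.refl a b c ⟩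
    (oneS +ₛ b +ₛ c *ₛ oneS) +ₛ a *ₛ (oneS +ₛ c)
      ≈⟨ +ₛ-congʳ (a *ₛ (oneS +ₛ c))
           (+ₛ-congˡ (oneS +ₛ b) (*ₛ-congʳ oneS (mono-≡ (ℕ.+-comm 2 (suc j))))) ⟩
    fib (suc j) 2 +ₛ mono (suc j) *ₛ fib (suc (suc j)) 1 ∎
    where
    open ≈-Reasoning
    a = mono (suc j)
    b = mono (suc (suc j))
    c = mono (suc (suc (suc j)))
  fib-recurrenceˡ j (suc (suc L)) = begin
    fib j (3 + L) +ₛ mono (j + (4 + L)) *ₛ fib j (2 + L)
      ≈⟨ R.+-cong (fib-recurrenceˡ j (suc L)) (*ₛ-cong (mono-≡ (ℕ.+-suc j (3 + L))) (fib-recurrenceˡ j L)) ⟩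
    (A +ₛ x *ₛ B) +ₛ z *ₛ (C +ₛ x *ₛ D)
      ≈⟨ solve 6 (λ A B C D x z → (A :+ x :* B) :+ z :* (C :+ x :* D) := (A :+ z :* C) :+ x :* (B :+ z :* D))
                 R.refl A B C D x z ⟩
    (A +ₛ z *ₛ C) +ₛ x *ₛ (B +ₛ z *ₛ D)
      ≈⟨ +ₛ-congˡ (A +ₛ z *ₛ C)
           (*ₛ-congˡ x (+ₛ-congˡ B (*ₛ-congʳ D (mono-≡ (cong suc (ℕ.+-suc j (2 + L))))))) ⟩
    fib (suc j) (3 + L) +ₛ x *ₛ fib (suc (suc j)) (2 + L) ∎
    where
    open ≈-Reasoning
    A = fib (suc j) (2 + L)
    B = fib (suc (suc j)) (1 + L)
    C = fib (suc j) (1 + L)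
    D = fib (suc (suc j)) L
    x = mono (suc j)
    z = mono (suc j + (3 + L))

  rogersRamanujanSum≈[]fib : ∀ N L j → N ≤ j + L → rogersRamanujanSum N j ≈[ N ] fib j L
  rogersRamanujanSum≈[]fib N zero          j N≤j+0 =
    rogersRamanujanSum-small[] N j (subst (N ≤_) (ℕ.+-identityʳ j) N≤j+0)
  rogersRamanujanSum≈[]fib N (suc zero)    j N≤j+1 = ≈[]-trans (rogersRamanujanSum-recurrence[] N j)
    (+ₛ-cong[] (rogersRamanujanSum-small[] N (suc j) N≤1+j)
               (≈[]-trans (*ₛ-congˡ[] (mono (suc j))
                            (rogersRamanujanSum-small[] N (suc (suc j)) (ℕ.m≤n⇒m≤1+n N≤1+j)))
                          (≈⇒≈[] (*ₛ-identityʳ (mono (suc j))))))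
    where N≤1+j = subst (N ≤_) (ℕ.+-comm j 1) N≤j+1
  rogersRamanujanSum≈[]fib N (suc (suc L)) j N≤j+L+2 = ≈[]-trans (rogersRamanujanSum-recurrence[] N j)
    (≈[]-trans (+ₛ-cong[]
      (rogersRamanujanSum≈[]fib N (suc L) (suc j) (subst (N ≤_) (ℕ.+-suc j (suc L)) N≤j+L+2))
                          (*ₛ-congˡ[] (mono (suc j)) (rogersRamanujanSum≈[]fib N L (suc (suc j))
                            (subst (N ≤_) (trans (ℕ.+-suc j (suc L)) (cong suc (ℕ.+-suc j L))) N≤j+L+2))))
               (≈⇒≈[] (R.sym (fib-recurrenceˡ j L))))

  1-q^≈[]oneS : ∀ {N} a → N < a → 1-q^ a ≈[ N ] oneS
  1-q^≈[]oneS a N<a = mk≈[] λ n n≤N →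
    trans (cong (λ c → oneS n ℤ.+ ℤ.- c) (q^∣mono a n (ℕ.≤-<-trans n≤N N<a))) (ℤ.+-identityʳ (oneS n))

  1+q^≈[]oneS : ∀ {N} a → N < a → 1+q^ a ≈[ N ] oneS
  1+q^≈[]oneS a N<a = mk≈[] λ n n≤N →
    trans (cong (λ c → oneS n ℤ.+ c) (q^∣mono a n (ℕ.≤-<-trans n≤N N<a))) (ℤ.+-identityʳ (oneS n))

  pochInf≈[]prodₛ : ∀ A B f N →
    (∀ m → poch A B m ≈ prodₛ f m) → (∀ n k → n ≤ k → f k ≈[ n ] oneS) →
    pochInf A B ≈[ N ] prodₛ f (suc N)
  pochInf≈[]prodₛ A B f N poch≈prod f≈1 = mk≈[] λ n n≤N → trans (at (poch≈prod (suc n)) n)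
    (sym (at≤ (prodₛ-extend f (suc n) (suc N) (s≤s n≤N) (λ k n<k → f≈1 n k (ℕ.<⇒≤ n<k))) n ℕ.≤-refl))

  -q²Poch-factor≈[]oneS : ∀ n k → n ≤ k → 1+q^ (2 + k * 2) ≈[ n ] oneS
  -q²Poch-factor≈[]oneS n k n≤k = 1+q^≈[]oneS (2 + k * 2)
    (ℕ.≤-trans (s≤s n≤k) (ℕ.≤-trans (ℕ.n≤1+n (suc k)) (ℕ.+-monoʳ-≤ 2 (ℕ.m≤m*n k 2))))

  qPoch-factor≈[]oneS : ∀ n k → n ≤ k → 1-q^ suc k ≈[ n ] oneS
  qPoch-factor≈[]oneS n k n≤k = 1-q^≈[]oneS (suc k) (s≤s n≤k)

  rhs110≈[]fib*ₛ1/qPoch : ∀ N → rhs110 ≈[ N ] fib 0 N *ₛ 1/qPoch N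
  rhs110≈[]fib*ₛ1/qPoch N = begin
    (infSum rhsTerm *ₛ pochInf (-ₛ mono 2) (mono 2)) *ₛ invS (pochInf (mono 1) (mono 1))
      ≈⟨ *ₛ-cong[] (*ₛ-cong[] (infSum≈[]sumₛ N rhsTerm rhsTerm-q^∣)
                              (pochInf≈[]prodₛ (-ₛ mono 2) (mono 2) _ N poch--q²≈-q²Poch -q²Poch-factor≈[]oneS))
                   (invS-cong[] (pochInf (mono 1) (mono 1)) (qPoch N) (qPoch-const N)
                     (≈[]-trans (pochInf≈[]prodₛ (mono 1) (mono 1) _ N poch-q≈qPoch qPoch-factor≈[]oneS)
                                (prodₛ-extend _ N (suc N) (ℕ.n≤1+n N) (qPoch-factor≈[]oneS N)))) ⟩
    (sumₛ N rhsTerm *ₛ -q²Poch (suc N)) *ₛ 1/qPoch N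
      ≈⟨ *ₛ-congʳ[] (1/qPoch N)
           (≈[]-trans (rhsSum-*ₛ--q²Poch≈[]rogersRamanujanSum N) (rogersRamanujanSum≈[]fib N N 0 ℕ.≤-refl)) ⟩
    fib 0 N *ₛ 1/qPoch N ∎
    where
    open ≈[]-Reasoning N
    rhsTerm-q^∣ : ∀ m → q^ m ∣ rhsTerm m
    rhsTerm-q^∣ m = q^∣-weaken (n≤n*n m) (q^∣mono-*ₛ (m * m) (invS (poch (mono 4) (mono 4) m)))

module Partitions where

  open import Defs
  open import Data.Nat using (ℕ; zero; suc; _+_; _∸_; _≤_; _<_; _≥_; z≤n; s≤s)
  import Data.Nat.Properties as ℕ
  open import Data.List using (List; []; _∷_; length; replicate)
  open import Data.Nat.ListAction using (sum)
  open import Data.List.Relation.Unary.All using (All; []; _∷_)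
  open import Data.List.Relation.Unary.Linked as Linked using (Linked; []; [-]; _∷_)
  open import Data.Product using (_,_)
  open import Relation.Binary.PropositionalEquality
  open import Relation.Nullary using (yes; no; contradiction)

  addColumn : ℕ → List ℕ → List ℕ
  addColumn zero    xs       = xs
  addColumn (suc ℓ) []       = 1 ∷ addColumn ℓ []
  addColumn (suc ℓ) (x ∷ xs) = suc x ∷ addColumn ℓ xs

  -- Everything after a part 1 is dropped: in a partition it consists of 1s.
  removeColumn : List ℕ → List ℕ
  removeColumn []                 = []
  removeColumn (zero ∷ _)         = []
  removeColumn (suc zero ∷ _)     = []
  removeColumn (suc (suc x) ∷ xs) = suc x ∷ removeColumn xs

  indicator< : ℕ → ℕ → ℕ
  indicator< j       zero    = 0
  indicator< zero    (suc ℓ) = 1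
  indicator< (suc j) (suc ℓ) = indicator< j ℓ

  indicator<≤1 : ∀ j ℓ → indicator< j ℓ ≤ 1
  indicator<≤1 j       zero    = z≤n
  indicator<≤1 zero    (suc ℓ) = s≤s z≤n
  indicator<≤1 (suc j) (suc ℓ) = indicator<≤1 j ℓ

  indicator<-mono : ∀ j {a b} → a ≤ b → indicator< j a ≤ indicator< j b
  indicator<-mono j       {zero}  z≤n     = z≤n
  indicator<-mono zero    {suc a} (s≤s _) = ℕ.≤-refl
  indicator<-mono (suc j) {suc a} (s≤s a≤b) = indicator<-mono j a≤b

  indicator<-shift : ∀ j d a → indicator< (j + d) (d + a) ≡ indicator< j a
  indicator<-shift j zero    a = cong (λ x → indicator< x a) (ℕ.+-identityʳ j)
  indicator<-shift j (suc d) a = trans (cong (λ x → indicator< x (suc (d + a))) (ℕ.+-suc j d)) (indicator<-shift j d a)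

  part-[] : ∀ j → part [] j ≡ 0
  part-[] zero    = refl
  part-[] (suc j) = refl

  part-beyond : ∀ xs j → length xs ≤ j → part xs j ≡ 0
  part-beyond []       j       _         = part-[] j
  part-beyond (x ∷ xs) (suc j) (s≤s len≤j) = part-beyond xs j len≤j

  part-positive : ∀ xs j → All (0 <_) xs → j < length xs → 0 < part xs j
  part-positive (x ∷ xs) zero    (x>0 ∷ _)  _         = x>0
  part-positive (x ∷ xs) (suc j) (_ ∷ xs>0) (s≤s j<len) = part-positive xs j xs>0 j<len

  part-≤-head : ∀ {x xs} → Linked _≥_ (x ∷ xs) → ∀ j → part xs j ≤ x
  part-≤-head {x} [-]         j       = subst (_≤ x) (sym (part-[] j)) z≤n
  part-≤-head     (x≥y ∷ _)   zero    = x≥y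
  part-≤-head     (x≥y ∷ ys↘) (suc j) = ℕ.≤-trans (part-≤-head ys↘ j) x≥y

  Linked-cons : ∀ {x ys} → Linked _≥_ ys → part ys 0 ≤ x → Linked _≥_ (x ∷ ys)
  Linked-cons {ys = []}    _   _       = [-]
  Linked-cons {ys = y ∷ _} ys↘ y≤x     = y≤x ∷ ys↘

  length≤sum : ∀ xs → All (0 <_) xs → length xs ≤ sum xs
  length≤sum []       []         = z≤n
  length≤sum (x ∷ xs) (x>0 ∷ xs>0) = ℕ.+-mono-≤ x>0 (length≤sum xs xs>0)

  interlacing⇒length-≤ : ∀ a b d → IsPartition a → (∀ j → part a (j + d) ≤ part b j) →
    length a ≤ d + length b
  interlacing⇒length-≤ a b d (_ , a>0) a≤b with length a ℕ.≤? d + length b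
  ... | yes ok = ok
  ... | no  too-long =
    contradiction (ℕ.<-≤-trans (part-positive a (length b + d) a>0 long) part≤0) (ℕ.<-irrefl refl)
    where
    long : length b + d < length a
    long = subst (_< length a) (ℕ.+-comm d (length b)) (ℕ.≰⇒> too-long)
    part≤0 : part a (length b + d) ≤ 0
    part≤0 = ℕ.≤-trans (a≤b (length b)) (ℕ.≤-reflexive (part-beyond b (length b) ℕ.≤-refl))

  part-addColumn : ∀ ℓ xs j → length xs ≤ ℓ → part (addColumn ℓ xs) j ≡ part xs j + indicator< j ℓ
  part-addColumn zero    []       j       z≤n         = trans (part-[] j) (sym (ℕ.+-identityʳ (part [] j)))
  part-addColumn (suc ℓ) []       zero    _           = refl
  part-addColumn (suc ℓ) []       (suc j) _           = part-addColumn ℓ [] j z≤n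
  part-addColumn (suc ℓ) (x ∷ xs) zero    _           = ℕ.+-comm 1 x
  part-addColumn (suc ℓ) (x ∷ xs) (suc j) (s≤s len≤ℓ) = part-addColumn ℓ xs j len≤ℓ

  length-addColumn : ∀ ℓ xs → length xs ≤ ℓ → length (addColumn ℓ xs) ≡ ℓ
  length-addColumn zero    []       z≤n         = refl
  length-addColumn (suc ℓ) []       _           = cong suc (length-addColumn ℓ [] z≤n)
  length-addColumn (suc ℓ) (x ∷ xs) (s≤s len≤ℓ) = cong suc (length-addColumn ℓ xs len≤ℓ)

  sum-addColumn : ∀ ℓ xs → length xs ≤ ℓ → sum (addColumn ℓ xs) ≡ ℓ + sum xs
  sum-addColumn zero    []       z≤n         = refl
  sum-addColumn (suc ℓ) []       _           = cong suc (sum-addColumn ℓ [] z≤n)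
  sum-addColumn (suc ℓ) (x ∷ xs) (s≤s len≤ℓ) = cong suc (begin
    x + sum (addColumn ℓ xs)  ≡⟨ cong (x +_) (sum-addColumn ℓ xs len≤ℓ) ⟩
    x + (ℓ + sum xs)          ≡⟨ ℕ.+-comm x (ℓ + sum xs) ⟩
    (ℓ + sum xs) + x          ≡⟨ ℕ.+-assoc ℓ (sum xs) x ⟩
    ℓ + (sum xs + x)          ≡⟨ cong (ℓ +_) (ℕ.+-comm (sum xs) x) ⟩
    ℓ + (x + sum xs)          ∎)
    where open ≡-Reasoning

  IsPartition-addColumn : ∀ ℓ xs → IsPartition xs → length xs ≤ ℓ → IsPartition (addColumn ℓ xs)
  IsPartition-addColumn ℓ xs (xs↘ , xs>0) len≤ℓ = decreasing ℓ xs xs↘ len≤ℓ , positive ℓ xs xs>0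
    where
    positive : ∀ ℓ xs → All (0 <_) xs → All (0 <_) (addColumn ℓ xs)
    positive zero    xs       xs>0       = xs>0
    positive (suc ℓ) []       _          = s≤s z≤n ∷ positive ℓ [] []
    positive (suc ℓ) (x ∷ xs) (_ ∷ xs>0) = s≤s z≤n ∷ positive ℓ xs xs>0
    decreasing : ∀ ℓ xs → Linked _≥_ xs → length xs ≤ ℓ → Linked _≥_ (addColumn ℓ xs)
    decreasing zero    xs       xs↘ _           = xs↘
    decreasing (suc ℓ) []       _   _           = Linked-cons (decreasing ℓ [] [] z≤n)
      (subst (_≤ 1) (sym (part-addColumn ℓ [] 0 z≤n)) (indicator<≤1 0 ℓ))
    decreasing (suc ℓ) (x ∷ xs) xs↘ (s≤s len≤ℓ) = Linked-cons (decreasing ℓ xs (Linked.tail xs↘) len≤ℓ)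
      (subst (_≤ suc x) (sym (part-addColumn ℓ xs 0 len≤ℓ))
        (subst (part xs 0 + indicator< 0 ℓ ≤_) (ℕ.+-comm x 1)
          (ℕ.+-mono-≤ (part-≤-head xs↘ 0) (indicator<≤1 0 ℓ))))

  part-removeColumn : ∀ xs → IsPartition xs → ∀ j → part (removeColumn xs) j ≡ part xs j ∸ 1
  part-removeColumn []                      _                j       = trans (part-[] j) (cong (_∸ 1) (sym (part-[] j)))
  part-removeColumn (zero ∷ xs)             (_ , () ∷ _)     j
  part-removeColumn (suc zero ∷ xs)         _                zero    = refl
  part-removeColumn (suc zero ∷ xs)         (xs↘ , _)        (suc j) =
    trans (part-[] j) (sym (ℕ.m≤n⇒m∸n≡0 (part-≤-head xs↘ j)))
  part-removeColumn (suc (suc x) ∷ xs)      _                zero    = refl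
  part-removeColumn (suc (suc x) ∷ [])      _                (suc j) = part-removeColumn [] ([] , []) j
  part-removeColumn (suc (suc x) ∷ y ∷ xs)  (_ ∷ xs↘ , _ ∷ xs>0) (suc j) =
    part-removeColumn (y ∷ xs) (xs↘ , xs>0) j

  length-removeColumn : ∀ xs → length (removeColumn xs) ≤ length xs
  length-removeColumn []                 = z≤n
  length-removeColumn (zero ∷ xs)        = z≤n
  length-removeColumn (suc zero ∷ xs)    = z≤n
  length-removeColumn (suc (suc x) ∷ xs) = s≤s (length-removeColumn xs)

  IsPartition-removeColumn : ∀ xs → IsPartition xs → IsPartition (removeColumn xs)
  IsPartition-removeColumn xs xs-partition = decreasing xs xs-partition , positive xs
    where
    positive : ∀ xs → All (0 <_) (removeColumn xs)
    positive []                 = []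
    positive (zero ∷ xs)        = []
    positive (suc zero ∷ xs)    = []
    positive (suc (suc x) ∷ xs) = s≤s z≤n ∷ positive xs
    decreasing : ∀ xs → IsPartition xs → Linked _≥_ (removeColumn xs)
    decreasing []                     _                    = []
    decreasing (zero ∷ xs)            _                    = []
    decreasing (suc zero ∷ xs)        _                    = []
    decreasing (suc (suc x) ∷ [])     _                    = [-]
    decreasing (suc (suc x) ∷ y ∷ xs) (y≤x ∷ xs↘ , _ ∷ xs>0) = Linked-cons (decreasing (y ∷ xs) (xs↘ , xs>0))
      (subst (_≤ suc x) (sym (part-removeColumn (y ∷ xs) (xs↘ , xs>0) 0)) (ℕ.∸-monoˡ-≤ 1 y≤x))

  private
    ones-after-1 : ∀ xs → IsPartition (1 ∷ xs) → xs ≡ replicate (length xs) 1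
    ones-after-1 []                 _                    = refl
    ones-after-1 (zero ∷ xs)        (_ , _ ∷ () ∷ _)
    ones-after-1 (suc zero ∷ xs)    (_ ∷ xs↘ , _ ∷ xs>0) = cong (1 ∷_) (ones-after-1 xs (xs↘ , xs>0))
    ones-after-1 (suc (suc y) ∷ xs) (s≤s () ∷ _ , _)

    addColumn-[] : ∀ ℓ → addColumn ℓ [] ≡ replicate ℓ 1
    addColumn-[] zero    = refl
    addColumn-[] (suc ℓ) = cong (1 ∷_) (addColumn-[] ℓ)

    sum-ones : ∀ n → sum (replicate n 1) ≡ n
    sum-ones zero    = refl
    sum-ones (suc n) = cong suc (sum-ones n)

  addColumn-removeColumn : ∀ xs → IsPartition xs → addColumn (length xs) (removeColumn xs) ≡ xs
  addColumn-removeColumn []                     _                    = refl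
  addColumn-removeColumn (zero ∷ xs)            (_ , () ∷ _)
  addColumn-removeColumn (suc zero ∷ xs)        xs-partition         =
    cong (1 ∷_) (trans (addColumn-[] (length xs)) (sym (ones-after-1 xs xs-partition)))
  addColumn-removeColumn (suc (suc x) ∷ [])     _                    = refl
  addColumn-removeColumn (suc (suc x) ∷ y ∷ xs) (_ ∷ xs↘ , _ ∷ xs>0) =
    cong (suc (suc x) ∷_) (addColumn-removeColumn (y ∷ xs) (xs↘ , xs>0))

  removeColumn-addColumn : ∀ ℓ xs → IsPartition xs → length xs ≤ ℓ → removeColumn (addColumn ℓ xs) ≡ xs
  removeColumn-addColumn zero    []           _                    z≤n           = refl
  removeColumn-addColumn (suc ℓ) []           _                    _             = refl
  removeColumn-addColumn (suc ℓ) (zero ∷ xs)  (_ , () ∷ _)         _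
  removeColumn-addColumn (suc ℓ) (suc x ∷ []) _                    (s≤s _)       =
    cong (suc x ∷_) (removeColumn-addColumn ℓ [] ([] , []) z≤n)
  removeColumn-addColumn (suc ℓ) (suc x ∷ y ∷ xs) (_ ∷ xs↘ , _ ∷ xs>0) (s≤s len≤ℓ) =
    cong (suc x ∷_) (removeColumn-addColumn ℓ (y ∷ xs) (xs↘ , xs>0) len≤ℓ)

  sum-removeColumn : ∀ xs → IsPartition xs → sum (removeColumn xs) + length xs ≡ sum xs
  sum-removeColumn []                     _                    = refl
  sum-removeColumn (zero ∷ xs)            (_ , () ∷ _)
  sum-removeColumn (suc zero ∷ xs)        xs-partition         = cong suc (begin
    length xs                        ≡⟨ sym (sum-ones (length xs)) ⟩
    sum (replicate (length xs) 1)    ≡⟨ cong sum (sym (ones-after-1 xs xs-partition)) ⟩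
    sum xs                           ∎)
    where open ≡-Reasoning
  sum-removeColumn (suc (suc x) ∷ [])     _                    = cong suc (ℕ.+-comm (x + 0) 1)
  sum-removeColumn (suc (suc x) ∷ y ∷ xs) (_ ∷ xs↘ , _ ∷ xs>0) = begin
    suc (x + sum (removeColumn (y ∷ xs))) + suc (suc (length xs))
      ≡⟨ cong suc (ℕ.+-suc (x + sum (removeColumn (y ∷ xs))) (suc (length xs))) ⟩
    suc (suc (x + sum (removeColumn (y ∷ xs)) + suc (length xs)))
      ≡⟨ cong (λ z → suc (suc z)) (trans (ℕ.+-assoc x _ _) (cong (x +_) (sum-removeColumn (y ∷ xs) (xs↘ , xs>0)))) ⟩
    suc (suc (x + sum (y ∷ xs))) ∎
    where open ≡-Reasoning

  part-addColumn-≤ : ∀ a b d ℓa ℓb j → length a ≤ ℓa → length b ≤ ℓb → ℓa ≤ d + ℓb →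
    part a (j + d) ≤ part b j → part (addColumn ℓa a) (j + d) ≤ part (addColumn ℓb b) j
  part-addColumn-≤ a b d ℓa ℓb j len-a len-b ℓa≤d+ℓb a≤b =
    subst₂ _≤_ (sym (part-addColumn ℓa a (j + d) len-a)) (sym (part-addColumn ℓb b j len-b))
      (ℕ.+-mono-≤ a≤b
        (subst (indicator< (j + d) ℓa ≤_) (indicator<-shift j d ℓb) (indicator<-mono (j + d) ℓa≤d+ℓb)))

  part-removeColumn-≤ : ∀ a b d j → IsPartition a → IsPartition b →
    part a (j + d) ≤ part b j → part (removeColumn a) (j + d) ≤ part (removeColumn b) j
  part-removeColumn-≤ a b d j a-partition b-partition a≤b =
    subst₂ _≤_ (sym (part-removeColumn a a-partition (j + d))) (sym (part-removeColumn b b-partition j))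
      (ℕ.∸-monoˡ-≤ 1 a≤b)

module Shapes where

  open import Data.Nat using (ℕ; zero; suc; _+_; _≤_; _<_; z≤n; s≤s)
  import Data.Nat.Properties as ℕ
  open import Data.Bool using (Bool; true; false)
  open import Data.Product using (Σ-syntax; _×_; _,_; proj₁; proj₂)
  open import Data.List using (List; []; _∷_)
  open import Data.List.Membership.Propositional using (_∈_; _∉_)
  open import Data.List.Relation.Unary.Any using (here; there)
  open import Data.List.Relation.Unary.All using (All; []; _∷_)
  open import Data.List.Relation.Unary.All.Properties.Core using (¬Any⇒All¬)
  open import Data.List.Relation.Unary.Unique.Propositional using (Unique)
  open import Data.List.Relation.Unary.AllPairs using ([]; _∷_)
  open import Relation.Binary.PropositionalEquality
  open import Relation.Nullary using (¬_; Dec; yes; no; contradiction)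
  open import Data.Sum using (inj₁; inj₂)
  open import Data.Nat.Tactic.RingSolver using (solve-∀)
  open import Function using (_∘_)
  open import Relation.Nullary.Decidable using (_×-dec_; from-yes; from-no)

  -- The heights of the first columns of the three partitions of a cylindric partition.
  Shape : Set
  Shape = ℕ × ℕ × ℕ

  infix 4 _⊑_ _⊑?_

  _⊑_ : Shape → Shape → Set
  (a , b , c) ⊑ (a′ , b′ , c′) = a ≤ a′ × b ≤ b′ × c ≤ c′

  _⊑?_ : ∀ s t → Dec (s ⊑ t)
  (a , b , c) ⊑? (a′ , b′ , c′) = a ℕ.≤? a′ ×-dec b ℕ.≤? b′ ×-dec c ℕ.≤? c′

  ⊑-refl : ∀ {s} → s ⊑ s
  ⊑-refl = ℕ.≤-refl , ℕ.≤-refl , ℕ.≤-refl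

  ⊑-trans : ∀ {s t u} → s ⊑ t → t ⊑ u → s ⊑ u
  ⊑-trans (a≤ , b≤ , c≤) (a≤′ , b≤′ , c≤′) =
    ℕ.≤-trans a≤ a≤′ , ℕ.≤-trans b≤ b≤′ , ℕ.≤-trans c≤ c≤′

  ⊑-reflexive : ∀ {s t} → s ≡ t → s ⊑ t
  ⊑-reflexive refl = ⊑-refl

  zero⊑ : ∀ s → (0 , 0 , 0) ⊑ s
  zero⊑ s = z≤n , z≤n , z≤n

  weight : Shape → ℕ
  weight (a , b , c) = a + b + c

  weight-mono : ∀ {s t} → s ⊑ t → weight s ≤ weight t
  weight-mono (a≤ , b≤ , c≤) = ℕ.+-mono-≤ (ℕ.+-mono-≤ a≤ b≤) c≤

  ⊑-weight-≡ : ∀ {s t} → s ⊑ t → weight s ≡ weight t → s ≡ t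
  ⊑-weight-≡ {a , b , c} {a′ , b′ , c′} (a≤ , b≤ , c≤) w≡ = cong₂ _,_ a≡ (cong₂ _,_ b≡ c≡)
    where
    c≡ = ℕ.≤-antisym c≤
      (ℕ.+-cancelˡ-≤ (a + b) c′ c (subst (a + b + c′ ≤_) (sym w≡) (ℕ.+-monoˡ-≤ c′ (ℕ.+-mono-≤ a≤ b≤))))
    ab≡ = ℕ.+-cancelʳ-≡ c (a + b) (a′ + b′) (trans w≡ (cong (a′ + b′ +_) (sym c≡)))
    b≡ = ℕ.≤-antisym b≤ (ℕ.+-cancelˡ-≤ a b′ b (subst (a + b′ ≤_) (sym ab≡) (ℕ.+-monoˡ-≤ b′ a≤)))
    a≡ = ℕ.+-cancelʳ-≡ b a a′ (trans ab≡ (cong (a′ +_) (sym b≡)))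

  -- The shapes of cylindric partitions with profile (1,1,0).
  Admissible : Shape → Set
  Admissible (a , b , c) = c ≤ b × b ≤ suc a × a ≤ suc c

  add111 : Shape → Shape
  add111 (a , b , c) = suc a , suc b , suc c

  add111-⊑⁻ : ∀ {s t} → add111 s ⊑ add111 t → s ⊑ t
  add111-⊑⁻ (s≤s a≤ , s≤s b≤ , s≤s c≤) = a≤ , b≤ , c≤

  add111-⊑ : ∀ {s t} → s ⊑ t → add111 s ⊑ add111 t
  add111-⊑ (a≤ , b≤ , c≤) = s≤s a≤ , s≤s b≤ , s≤s c≤

  -- Every weight k+1 has exactly two nonzero admissible shapes, ι k false and ι k true.
  ι : ℕ → Bool → Shape
  ι 0 false = 0 , 1 , 0
  ι 0 true  = 1 , 0 , 0
  ι 1 false = 1 , 1 , 0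
  ι 1 true  = 0 , 1 , 1
  ι 2 false = 1 , 1 , 1
  ι 2 true  = 1 , 2 , 0
  ι (suc (suc (suc k))) e = add111 (ι k e)

  admissible? : ∀ s → Dec (Admissible s)
  admissible? (a , b , c) = c ℕ.≤? b ×-dec b ℕ.≤? suc a ×-dec a ℕ.≤? suc c

  ι-admissible : ∀ k e → Admissible (ι k e)
  ι-admissible 0 false = from-yes (admissible? (ι 0 false))
  ι-admissible 0 true  = from-yes (admissible? (ι 0 true))
  ι-admissible 1 false = from-yes (admissible? (ι 1 false))
  ι-admissible 1 true  = from-yes (admissible? (ι 1 true))
  ι-admissible 2 false = from-yes (admissible? (ι 2 false))
  ι-admissible 2 true  = from-yes (admissible? (ι 2 true))
  ι-admissible (suc (suc (suc k))) e with ι-admissible k e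
  ... | c≤b , b≤a+1 , a≤c+1 = s≤s c≤b , s≤s b≤a+1 , s≤s a≤c+1

  weight-add111 : ∀ s → weight (add111 s) ≡ 3 + weight s
  weight-add111 (a , b , c) = arrange a b c
    where
    arrange : ∀ a b c → suc a + suc b + suc c ≡ 3 + (a + b + c)
    arrange = solve-∀

  weight-ι : ∀ k e → weight (ι k e) ≡ suc k
  weight-ι 0 false = refl
  weight-ι 0 true  = refl
  weight-ι 1 false = refl
  weight-ι 1 true  = refl
  weight-ι 2 false = refl
  weight-ι 2 true  = refl
  weight-ι (suc (suc (suc k))) e = trans (weight-add111 (ι k e)) (cong (3 +_) (weight-ι k e))

  ι-injective : ∀ {k e k′ e′} → ι k e ≡ ι k′ e′ → k ≡ k′ × e ≡ e′
  ι-injective {k} {e} {k′} {e′} ι≡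
    with ℕ.suc-injective (trans (sym (weight-ι k e)) (trans (cong weight ι≡) (weight-ι k′ e′)))
  ... | refl = refl , flag-injective k e e′ ι≡
    where
    flag-injective : ∀ k e e′ → ι k e ≡ ι k e′ → e ≡ e′
    flag-injective k                   false false _ = refl
    flag-injective k                   true  true  _ = refl
    flag-injective 0                   false true  ()
    flag-injective 0                   true  false ()
    flag-injective 1                   false true  ()
    flag-injective 1                   true  false ()
    flag-injective 2                   false true  ()
    flag-injective 2                   true  false ()
    flag-injective (suc (suc (suc k))) e     e′    ι≡ = flag-injective k e e′ (add111-injective ι≡)
      where
      add111-injective : ∀ {s t} → add111 s ≡ add111 t → s ≡ t
      add111-injective refl = refl

  private
    lower : ∀ {a b c} → Admissible (suc a , suc b , suc c) → Admissible (a , b , c)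
    lower (s≤s c≤b , s≤s b≤a+1 , s≤s a≤c+1) = c≤b , b≤a+1 , a≤c+1

    lift : ∀ {s} → Σ[ k ∈ ℕ ] Σ[ e ∈ Bool ] ι k e ≡ s → Σ[ k ∈ ℕ ] Σ[ e ∈ Bool ] ι k e ≡ add111 s
    lift (k , e , ι≡s) = suc (suc (suc k)) , e , cong add111 ι≡s

  ι-surjective : ∀ a b c → Admissible (a , b , c) → (a , b , c) ≢ (0 , 0 , 0) →
    Σ[ k ∈ ℕ ] Σ[ e ∈ Bool ] ι k e ≡ (a , b , c)
  ι-surjective 0 0 0                         _                 s≢0 = contradiction refl s≢0
  ι-surjective 0 1 0                         _                 _   = 0 , false , refl
  ι-surjective 1 0 0                         _                 _   = 0 , true , refl
  ι-surjective 1 1 0                         _                 _   = 1 , false , refl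
  ι-surjective 0 1 1                         _                 _   = 1 , true , refl
  ι-surjective 1 1 1                         _                 _   = 2 , false , refl
  ι-surjective 1 2 0                         _                 _   = 2 , true , refl
  ι-surjective 0 (suc (suc b)) c             (_ , s≤s () , _)  _
  ι-surjective 1 (suc (suc (suc b))) c       (_ , s≤s (s≤s ()) , _) _
  ι-surjective (suc (suc a)) b 0             (_ , _ , s≤s ())  _
  ι-surjective a 0 (suc c)                   (() , _ , _)      _
  ι-surjective 0 1 (suc (suc c))             (s≤s () , _ , _)  _
  ι-surjective (suc (suc a)) (suc b) (suc c) adm               _   = lift (ι-surjective (suc a) b c (lower adm) λ ())
  ι-surjective 1 (suc (suc b)) (suc c)       adm               _   = lift (ι-surjective 0 (suc b) c (lower adm) λ ())
  ι-surjective 1 1 (suc (suc c))             adm               _   = lift (ι-surjective 0 0 (suc c) (lower adm) λ ())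

  ι-⊑-ι-suc-false : ∀ k e → ι k e ⊑ ι (suc k) false
  ι-⊑-ι-suc-false 0 false = from-yes (ι 0 false ⊑? ι 1 false)
  ι-⊑-ι-suc-false 0 true  = from-yes (ι 0 true  ⊑? ι 1 false)
  ι-⊑-ι-suc-false 1 false = from-yes (ι 1 false ⊑? ι 2 false)
  ι-⊑-ι-suc-false 1 true  = from-yes (ι 1 true  ⊑? ι 2 false)
  ι-⊑-ι-suc-false 2 false = from-yes (ι 2 false ⊑? ι 3 false)
  ι-⊑-ι-suc-false 2 true  = from-yes (ι 2 true  ⊑? ι 3 false)
  ι-⊑-ι-suc-false (suc (suc (suc k))) e = add111-⊑ (ι-⊑-ι-suc-false k e)

  ι-false-⊑-ι-suc : ∀ k e → ι k false ⊑ ι (suc k) e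
  ι-false-⊑-ι-suc 0 false = from-yes (ι 0 false ⊑? ι 1 false)
  ι-false-⊑-ι-suc 0 true  = from-yes (ι 0 false ⊑? ι 1 true)
  ι-false-⊑-ι-suc 1 false = from-yes (ι 1 false ⊑? ι 2 false)
  ι-false-⊑-ι-suc 1 true  = from-yes (ι 1 false ⊑? ι 2 true)
  ι-false-⊑-ι-suc 2 false = from-yes (ι 2 false ⊑? ι 3 false)
  ι-false-⊑-ι-suc 2 true  = from-yes (ι 2 false ⊑? ι 3 true)
  ι-false-⊑-ι-suc (suc (suc (suc k))) e = add111-⊑ (ι-false-⊑-ι-suc k e)

  ι-true-⋢-ι-suc-true : ∀ k → ¬ (ι k true ⊑ ι (suc k) true)
  ι-true-⋢-ι-suc-true 0 = from-no (ι 0 true ⊑? ι 1 true)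
  ι-true-⋢-ι-suc-true 1 = from-no (ι 1 true ⊑? ι 2 true)
  ι-true-⋢-ι-suc-true 2 = from-no (ι 2 true ⊑? ι 3 true)
  ι-true-⋢-ι-suc-true (suc (suc (suc k))) = ι-true-⋢-ι-suc-true k ∘ add111-⊑⁻

  ι-⊑-ι-false : ∀ {k′ k} e′ → k′ < k → ι k′ e′ ⊑ ι k false
  ι-⊑-ι-false {k′} {suc k} e′ (s≤s k′≤k) with k′ ℕ.≟ k
  ... | yes refl = ι-⊑-ι-suc-false k′ e′
  ... | no  k′≢k = ⊑-trans (ι-⊑-ι-false e′ (ℕ.≤∧≢⇒< k′≤k k′≢k)) (ι-⊑-ι-suc-false k false)

  Code : Set
  Code = ℕ × Bool

  ιᶜ : Code → Shape
  ιᶜ (k , e) = ι k e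

  codes< : ℕ → List Code
  codes< zero    = []
  codes< (suc k) = (k , false) ∷ (k , true) ∷ codes< k

  -- The codes of the shapes below ι k e: all smaller weights, except that
  -- ι k true and ι (k+1) true are incomparable.
  codes⊑ : Code → List Code
  codes⊑ (k ,       false) = (k , false) ∷ codes< k
  codes⊑ (zero ,    true)  = (zero , true) ∷ []
  codes⊑ (suc k ,   true)  = (suc k , true) ∷ (k , false) ∷ codes< k

  ∈-codes<⁻ : ∀ k {c} → c ∈ codes< k → proj₁ c < k
  ∈-codes<⁻ (suc k) (here refl)         = ℕ.≤-refl
  ∈-codes<⁻ (suc k) (there (here refl)) = ℕ.≤-refl
  ∈-codes<⁻ (suc k) (there (there c∈))  = ℕ.m≤n⇒m≤1+n (∈-codes<⁻ k c∈)

  ∈-codes<⁺ : ∀ {k k′} e′ → k′ < k → (k′ , e′) ∈ codes< k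
  ∈-codes<⁺ {suc k} {k′} e′ (s≤s k′≤k) with k′ ℕ.≟ k
  ∈-codes<⁺ {suc k} false (s≤s k′≤k) | yes refl = here refl
  ∈-codes<⁺ {suc k} true  (s≤s k′≤k) | yes refl = there (here refl)
  ... | no k′≢k = there (there (∈-codes<⁺ e′ (ℕ.≤∧≢⇒< k′≤k k′≢k)))

  ∈-codes⊑⁻ : ∀ c {c′} → c′ ∈ codes⊑ c → ιᶜ c′ ⊑ ιᶜ c
  ∈-codes⊑⁻ (k , false)     (here refl)         = ⊑-refl
  ∈-codes⊑⁻ (k , false)     (there c′∈)         = ι-⊑-ι-false _ (∈-codes<⁻ k c′∈)
  ∈-codes⊑⁻ (zero , true)   (here refl)         = ⊑-refl
  ∈-codes⊑⁻ (suc k , true)  (here refl)         = ⊑-refl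
  ∈-codes⊑⁻ (suc k , true)  (there (here refl)) = ι-false-⊑-ι-suc k true
  ∈-codes⊑⁻ (suc k , true)  (there (there c′∈)) =
    ⊑-trans (ι-⊑-ι-false _ (∈-codes<⁻ k c′∈)) (ι-false-⊑-ι-suc k true)

  ι-⊑⇒≤ : ∀ k′ e′ k e → ι k′ e′ ⊑ ι k e → k′ ≤ k
  ι-⊑⇒≤ k′ e′ k e ι⊑ = ℕ.≤-pred (subst₂ _≤_ (weight-ι k′ e′) (weight-ι k e) (weight-mono ι⊑))

  ι-⊑-flag : ∀ k e′ e → ι k e′ ⊑ ι k e → e′ ≡ e
  ι-⊑-flag k e′ e ι⊑ =
    proj₂ (ι-injective {k} {e′} {k} {e} (⊑-weight-≡ ι⊑ (trans (weight-ι k e′) (sym (weight-ι k e)))))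

  ∈-codes⊑-self : ∀ c → c ∈ codes⊑ c
  ∈-codes⊑-self (k ,     false) = here refl
  ∈-codes⊑-self (zero ,  true)  = here refl
  ∈-codes⊑-self (suc k , true)  = here refl

  ∈-codes⊑-lower : ∀ {k′} k e e′ → k′ < k → ι k′ e′ ⊑ ι k e → (k′ , e′) ∈ codes⊑ (k , e)
  ∈-codes⊑-lower k       false e′ k′<k _ = there (∈-codes<⁺ e′ k′<k)
  ∈-codes⊑-lower {k′} (suc k) true e′ (s≤s k′≤k) ι⊑ with k′ ℕ.≟ k
  ∈-codes⊑-lower (suc k) true false (s≤s k′≤k) ι⊑ | yes refl = there (here refl)
  ∈-codes⊑-lower (suc k) true true  (s≤s k′≤k) ι⊑ | yes refl = contradiction ι⊑ (ι-true-⋢-ι-suc-true k)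
  ... | no k′≢k = there (there (∈-codes<⁺ e′ (ℕ.≤∧≢⇒< k′≤k k′≢k)))

  ∈-codes⊑⁺ : ∀ c c′ → ιᶜ c′ ⊑ ιᶜ c → c′ ∈ codes⊑ c
  ∈-codes⊑⁺ (k , e) (k′ , e′) ι⊑ with ℕ.m≤n⇒m<n∨m≡n (ι-⊑⇒≤ k′ e′ k e ι⊑)
  ... | inj₁ k′<k = ∈-codes⊑-lower k e e′ k′<k ι⊑
  ... | inj₂ refl = subst (λ f → (k , f) ∈ codes⊑ (k , e)) (sym (ι-⊑-flag k e′ e ι⊑)) (∈-codes⊑-self (k , e))

  ∉-codes< : ∀ {k k′ e} → k ≤ k′ → (k′ , e) ∉ codes< k
  ∉-codes< {k} k≤k′ k′∈ = ℕ.<-irrefl refl (ℕ.<-≤-trans (∈-codes<⁻ k k′∈) k≤k′)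

  codes<-unique : ∀ k → Unique (codes< k)
  codes<-unique zero    = []
  codes<-unique (suc k) = ((λ ()) ∷ fresh) ∷ fresh ∷ codes<-unique k
    where
    fresh : ∀ {e} → All ((k , e) ≢_) (codes< k)
    fresh = ¬Any⇒All¬ (codes< k) (∉-codes< ℕ.≤-refl)

  codes⊑-unique : ∀ c → Unique (codes⊑ c)
  codes⊑-unique (k ,     false) = ¬Any⇒All¬ (codes< k) (∉-codes< ℕ.≤-refl) ∷ codes<-unique k
  codes⊑-unique (zero ,  true)  = [] ∷ []
  codes⊑-unique (suc k , true)  =
    ((λ ()) ∷ ¬Any⇒All¬ (codes< k) (∉-codes< (ℕ.n≤1+n k))) ∷
    ¬Any⇒All¬ (codes< k) (∉-codes< ℕ.≤-refl) ∷
    codes<-unique k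

module CylindricPartitions where

  open import Defs
  open Partitions
  open Shapes
  open import Data.Nat using (ℕ; zero; suc; _+_; _∸_; _≤_; _<_; z≤n)
  import Data.Nat.Properties as ℕ
  open import Data.Nat.Tactic.RingSolver using (solve-∀)
  open import Data.Nat.ListAction using (sum)
  open import Data.Bool using (Bool; false)
  open import Data.Fin using (zero; suc)
  open import Data.Vec using (Vec; []; _∷_)
  open import Data.List using (List; []; _∷_; _++_; map; concatMap; length)
  import Data.List.Properties as List
  open import Data.List.Membership.Propositional using (_∈_; _∉_; find; lose)
  import Data.List.Membership.Propositional.Properties as ∈
  open import Data.List.Relation.Unary.Any using (here; there)
  open import Data.List.Relation.Unary.All using ([]; lookup)
  open import Data.List.Relation.Unary.All.Properties.Core using (¬Any⇒All¬)
  open import Data.List.Relation.Unary.Unique.Propositional using (Unique)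
  import Data.List.Relation.Unary.Unique.Propositional.Properties as Unique
  open import Data.List.Relation.Unary.AllPairs using ([]; _∷_)
  open import Data.List.Relation.Unary.Linked using ([])
  open import Data.Product using (Σ-syntax; _×_; _,_; proj₁; proj₂)
  open import Data.Sum using (_⊎_; inj₁; inj₂)
  open import Function.Bundles using (_⇔_; mk⇔; Equivalence)
  open import Relation.Binary.PropositionalEquality
  open import Relation.Nullary using (¬_; yes; no; contradiction)

  Triple : Set
  Triple = Vec (List ℕ) 3

  Cylindric : Triple → Set
  Cylindric (x ∷ y ∷ z ∷ []) = IsPartition x × IsPartition y × IsPartition z ×
    (∀ j → part y (j + 1) ≤ part x j) × (∀ j → part z (j + 0) ≤ part y j) ×
    (∀ j → part x (j + 1) ≤ part z j)

  IsCylindric⇔Cylindric : ∀ Λ → IsCylindric profile110 Λ ⇔ Cylindric Λ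
  IsCylindric⇔Cylindric (x ∷ y ∷ z ∷ []) = mk⇔
    (λ (partitions , interlaced) → partitions zero , partitions (suc zero) , partitions (suc (suc zero)) ,
                                   interlaced zero , interlaced (suc zero) , interlaced (suc (suc zero)))
    (λ (x-part , y-part , z-part , y≤x , z≤y , x≤z) →
       (λ { zero → x-part ; (suc zero) → y-part ; (suc (suc zero)) → z-part }) ,
       (λ { zero → y≤x ; (suc zero) → z≤y ; (suc (suc zero)) → x≤z }))

  empty : Triple
  empty = [] ∷ [] ∷ [] ∷ []

  Cylindric-empty : Cylindric empty
  Cylindric-empty = ([] , []) , ([] , []) , ([] , []) , none 1 , none 0 , none 1
    where
    none : ∀ d j → part [] (j + d) ≤ part [] j
    none d j = subst (_≤ part [] j) (sym (part-[] (j + d))) z≤n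

  shape : Triple → Shape
  shape (x ∷ y ∷ z ∷ []) = length x , length y , length z

  addColumns : Shape → Triple → Triple
  addColumns (a , b , c) (x ∷ y ∷ z ∷ []) = addColumn a x ∷ addColumn b y ∷ addColumn c z ∷ []

  removeColumns : Triple → Triple
  removeColumns (x ∷ y ∷ z ∷ []) = removeColumn x ∷ removeColumn y ∷ removeColumn z ∷ []

  shape-admissible : ∀ Λ → Cylindric Λ → Admissible (shape Λ)
  shape-admissible (x ∷ y ∷ z ∷ []) (x-part , y-part , z-part , y≤x , z≤y , x≤z) =
    interlacing⇒length-≤ z y 0 z-part z≤y ,
    interlacing⇒length-≤ y x 1 y-part y≤x ,
    interlacing⇒length-≤ x z 1 x-part x≤z

  weight≤size : ∀ Λ → Cylindric Λ → weight (shape Λ) ≤ size Λ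
  weight≤size (x ∷ y ∷ z ∷ []) ((_ , x>0) , (_ , y>0) , (_ , z>0) , _) =
    subst (length x + length y + length z ≤_) (arrange (sum x) (sum y) (sum z))
      (ℕ.+-mono-≤ (ℕ.+-mono-≤ (length≤sum x x>0) (length≤sum y y>0)) (length≤sum z z>0))
    where
    arrange : ∀ a b c → a + b + c ≡ a + (b + (c + 0))
    arrange = solve-∀

  Cylindric-addColumns : ∀ s Λ → Cylindric Λ → shape Λ ⊑ s → Admissible s → Cylindric (addColumns s Λ)
  Cylindric-addColumns (a , b , c) (x ∷ y ∷ z ∷ []) (x-part , y-part , z-part , y≤x , z≤y , x≤z)
                       (x≤a , y≤b , z≤c) (c≤b , b≤a+1 , a≤c+1) =
    IsPartition-addColumn a x x-part x≤a ,
    IsPartition-addColumn b y y-part y≤b ,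
    IsPartition-addColumn c z z-part z≤c ,
    (λ j → part-addColumn-≤ y x 1 b a j y≤b x≤a b≤a+1 (y≤x j)) ,
    (λ j → part-addColumn-≤ z y 0 c b j z≤c y≤b c≤b (z≤y j)) ,
    (λ j → part-addColumn-≤ x z 1 a c j x≤a z≤c a≤c+1 (x≤z j))

  Cylindric-removeColumns : ∀ Λ → Cylindric Λ → Cylindric (removeColumns Λ)
  Cylindric-removeColumns (x ∷ y ∷ z ∷ []) (x-part , y-part , z-part , y≤x , z≤y , x≤z) =
    IsPartition-removeColumn x x-part , IsPartition-removeColumn y y-part , IsPartition-removeColumn z z-part ,
    (λ j → part-removeColumn-≤ y x 1 j y-part x-part (y≤x j)) ,
    (λ j → part-removeColumn-≤ z y 0 j z-part y-part (z≤y j)) ,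
    (λ j → part-removeColumn-≤ x z 1 j x-part z-part (x≤z j))

  shape-addColumns : ∀ s Λ → shape Λ ⊑ s → shape (addColumns s Λ) ≡ s
  shape-addColumns (a , b , c) (x ∷ y ∷ z ∷ []) (x≤a , y≤b , z≤c) =
    cong₂ _,_ (length-addColumn a x x≤a) (cong₂ _,_ (length-addColumn b y y≤b) (length-addColumn c z z≤c))

  shape-removeColumns : ∀ Λ → shape (removeColumns Λ) ⊑ shape Λ
  shape-removeColumns (x ∷ y ∷ z ∷ []) = length-removeColumn x , length-removeColumn y , length-removeColumn z

  removeColumns-addColumns : ∀ s Λ → Cylindric Λ → shape Λ ⊑ s → removeColumns (addColumns s Λ) ≡ Λ
  removeColumns-addColumns (a , b , c) (x ∷ y ∷ z ∷ []) (x-part , y-part , z-part , _) (x≤a , y≤b , z≤c) =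
    cong₂ _∷_ (removeColumn-addColumn a x x-part x≤a)
      (cong₂ _∷_ (removeColumn-addColumn b y y-part y≤b)
        (cong₂ _∷_ (removeColumn-addColumn c z z-part z≤c) refl))

  addColumns-removeColumns : ∀ Λ → Cylindric Λ → addColumns (shape Λ) (removeColumns Λ) ≡ Λ
  addColumns-removeColumns (x ∷ y ∷ z ∷ []) (x-part , y-part , z-part , _) =
    cong₂ _∷_ (addColumn-removeColumn x x-part)
      (cong₂ _∷_ (addColumn-removeColumn y y-part) (cong₂ _∷_ (addColumn-removeColumn z z-part) refl))

  size-addColumns : ∀ s Λ → shape Λ ⊑ s → size (addColumns s Λ) ≡ weight s + size Λ
  size-addColumns (a , b , c) (x ∷ y ∷ z ∷ []) (x≤a , y≤b , z≤c)
    rewrite sum-addColumn a x x≤a | sum-addColumn b y y≤b | sum-addColumn c z z≤c =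
    arrange a (sum x) b (sum y) c (sum z)
    where
    arrange : ∀ a u b v c w → a + u + (b + v + (c + w + 0)) ≡ a + b + c + (u + (v + (w + 0)))
    arrange = solve-∀

  size-removeColumns : ∀ Λ → Cylindric Λ → size (removeColumns Λ) + weight (shape Λ) ≡ size Λ
  size-removeColumns (x ∷ y ∷ z ∷ []) (x-part , y-part , z-part , _) =
    trans (arrange (sum (removeColumn x)) (sum (removeColumn y)) (sum (removeColumn z)) (length x) (length y) (length z))
          (cong₂ _+_ (sum-removeColumn x x-part)
            (cong₂ _+_ (sum-removeColumn y y-part) (cong (_+ 0) (sum-removeColumn z z-part))))
    where
    arrange : ∀ u v w a b c → u + (v + (w + 0)) + (a + b + c) ≡ u + a + (v + b + (w + c + 0))
    arrange = solve-∀

  Unique-concatMap : ∀ {A B : Set} (g : A → List B) {xs} → Unique xs → (∀ a → Unique (g a)) →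
    (∀ {a b y} → y ∈ g a → y ∈ g b → a ≡ b) → Unique (concatMap g xs)
  Unique-concatMap g {[]}     []                  _        _          = []
  Unique-concatMap g {x ∷ xs} (x∉xs ∷ xs-unique) g-unique g-disjoint =
    Unique.++⁺ (g-unique x) (Unique-concatMap g xs-unique g-unique g-disjoint) λ (y∈gx , y∈rest) →
      let b , b∈xs , y∈gb = find (∈.∈-concatMap⁻ g {xs = xs} y∈rest)
      in lookup x∉xs b∈xs (g-disjoint y∈gx y∈gb)

  Unique-map : ∀ {A B : Set} (h : A → B) (r : B → A) {xs} → (∀ {x} → x ∈ xs → r (h x) ≡ x) →
    Unique xs → Unique (map h xs)
  Unique-map h r {[]}     _      []                 = []
  Unique-map h r {x ∷ xs} r∘h≡id (x∉xs ∷ xs-unique) =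
    ¬Any⇒All¬ (map h xs) (λ hx∈ → let y , y∈xs , hx≡hy = ∈.∈-map⁻ h hx∈ in
      lookup x∉xs y∈xs (trans (sym (r∘h≡id (here refl))) (trans (cong r hx≡hy) (r∘h≡id (there y∈xs)))))
    ∷ Unique-map h r (λ x∈ → r∘h≡id (there x∈)) xs-unique

  Counted : ℕ → Code → Triple → Set
  Counted n c Λ = Cylindric Λ × size Λ ≡ n × shape Λ ⊑ ιᶜ c

  emptyIfZero : ℕ → List Triple
  emptyIfZero zero    = empty ∷ []
  emptyIfZero (suc _) = []

  -- The first argument is fuel for termination; any f ≥ n gives the same list.
  mutual
    enumerate : ℕ → ℕ → Code → List Triple
    enumerate f n c = emptyIfZero n ++ nonempty f n c

    nonempty : ℕ → ℕ → Code → List Triple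
    nonempty zero    n c = []
    nonempty (suc f) n c = concatMap (withFirstColumns f n) (codes⊑ c)

    withFirstColumns : ℕ → ℕ → Code → List Triple
    withFirstColumns f n (k , e) with suc k ℕ.≤? n
    ... | yes _ = map (addColumns (ι k e)) (enumerate f (n ∸ suc k) (k , e))
    ... | no  _ = []

  ∈-emptyIfZero : ∀ n {Λ} → Λ ∈ emptyIfZero n → n ≡ 0 × Λ ≡ empty
  ∈-emptyIfZero zero (here refl) = refl , refl

  ∈-withFirstColumns⁻ : ∀ f n k e {Λ} → Λ ∈ withFirstColumns f n (k , e) →
    suc k ≤ n × Σ[ Λ′ ∈ Triple ] Λ′ ∈ enumerate f (n ∸ suc k) (k , e) × Λ ≡ addColumns (ι k e) Λ′
  ∈-withFirstColumns⁻ f n k e Λ∈ with suc k ℕ.≤? n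
  ... | yes k<n = k<n , ∈.∈-map⁻ (addColumns (ι k e)) Λ∈

  ∈-nonempty⁻ : ∀ f n c {Λ} → Λ ∈ nonempty (suc f) n c →
    Σ[ c′ ∈ Code ] c′ ∈ codes⊑ c × Λ ∈ withFirstColumns f n c′
  ∈-nonempty⁻ f n c Λ∈ = find (∈.∈-concatMap⁻ (withFirstColumns f n) {xs = codes⊑ c} Λ∈)

  enumerate-sound : ∀ f n c {Λ} → Λ ∈ enumerate f n c → Counted n c Λ
  enumerate-sound f n c Λ∈ with ∈.∈-++⁻ (emptyIfZero n) Λ∈
  ... | inj₁ Λ∈₀ with ∈-emptyIfZero n Λ∈₀
  ...   | refl , refl = Cylindric-empty , refl , zero⊑ (ιᶜ c)
  enumerate-sound (suc f) n c Λ∈ | inj₂ Λ∈₊ with ∈-nonempty⁻ f n c Λ∈₊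
  ... | (k , e) , c′∈ , Λ∈w with ∈-withFirstColumns⁻ f n k e Λ∈w
  ... | k<n , Λ′ , Λ′∈ , refl with enumerate-sound f (n ∸ suc k) (k , e) Λ′∈
  ... | Λ′-cylindric , Λ′-size , Λ′⊑ =
    Cylindric-addColumns (ι k e) Λ′ Λ′-cylindric Λ′⊑ (ι-admissible k e) ,
    trans (size-addColumns (ι k e) Λ′ Λ′⊑) (trans (cong₂ _+_ (weight-ι k e) Λ′-size) (ℕ.m+[n∸m]≡n k<n)) ,
    subst (_⊑ ιᶜ c) (sym (shape-addColumns (ι k e) Λ′ Λ′⊑)) (∈-codes⊑⁻ c c′∈)

  withFirstColumns-shape : ∀ f n k e {Λ} → Λ ∈ withFirstColumns f n (k , e) → shape Λ ≡ ι k e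
  withFirstColumns-shape f n k e Λ∈ with ∈-withFirstColumns⁻ f n k e Λ∈
  ... | _ , Λ′ , Λ′∈ , refl =
    shape-addColumns (ι k e) Λ′ (proj₂ (proj₂ (enumerate-sound f (n ∸ suc k) (k , e) Λ′∈)))

  empty⊎nonzero : ∀ Λ → (Λ ≡ empty) ⊎ (shape Λ ≢ (0 , 0 , 0))
  empty⊎nonzero ([] ∷ [] ∷ [] ∷ [])        = inj₁ refl
  empty⊎nonzero ((_ ∷ _) ∷ _ ∷ _ ∷ [])     = inj₂ λ ()
  empty⊎nonzero ([] ∷ (_ ∷ _) ∷ _ ∷ [])    = inj₂ λ ()
  empty⊎nonzero ([] ∷ [] ∷ (_ ∷ _) ∷ [])   = inj₂ λ ()

  firstColumnsCode : ∀ Λ → Cylindric Λ → shape Λ ≢ (0 , 0 , 0) → Σ[ k ∈ ℕ ] Σ[ e ∈ Bool ] ι k e ≡ shape Λ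
  firstColumnsCode Λ@(x ∷ y ∷ z ∷ []) cylindric =
    ι-surjective (length x) (length y) (length z) (shape-admissible Λ cylindric)

  firstColumnsCode-< : ∀ Λ cylindric nonzero → proj₁ (firstColumnsCode Λ cylindric nonzero) < size Λ
  firstColumnsCode-< Λ cylindric nonzero with firstColumnsCode Λ cylindric nonzero
  ... | k , e , ι≡shape =
    subst (_≤ size Λ) (trans (cong weight (sym ι≡shape)) (weight-ι k e)) (weight≤size Λ cylindric)

  shape-⊑-ι-size : ∀ Λ → Cylindric Λ → shape Λ ⊑ ι (size Λ) false
  shape-⊑-ι-size Λ cylindric with empty⊎nonzero Λ
  ... | inj₁ refl    = zero⊑ (ι 0 false)
  ... | inj₂ nonzero with firstColumnsCode Λ cylindric nonzero | firstColumnsCode-< Λ cylindric nonzero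
  ...   | k , e , ι≡shape | k<size = subst (_⊑ ι (size Λ) false) ι≡shape (ι-⊑-ι-false e k<size)

  mutual
    enumerate-complete : ∀ f n c Λ → n ≤ f → Counted n c Λ → Λ ∈ enumerate f n c
    enumerate-complete f n c Λ n≤f (cylindric , size≡n , Λ⊑) with empty⊎nonzero Λ
    ... | inj₁ refl    = subst (λ m → empty ∈ enumerate f m c) size≡n (here refl)
    ... | inj₂ nonzero = nonempty-complete f n c Λ n≤f (cylindric , size≡n , Λ⊑) nonzero

    nonempty-complete : ∀ f n c Λ → n ≤ f → Counted n c Λ → shape Λ ≢ (0 , 0 , 0) →
      Λ ∈ enumerate f n c
    nonempty-complete f n c Λ n≤f (cylindric , size≡n , Λ⊑) nonzero =
      ∈.∈-++⁺ʳ (emptyIfZero n) (∈-nonempty n≤f)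
      where
      code = firstColumnsCode Λ cylindric nonzero
      k = proj₁ code
      e = proj₁ (proj₂ code)
      ι≡shape : ι k e ≡ shape Λ
      ι≡shape = proj₂ (proj₂ code)
      k<n : suc k ≤ n
      k<n = subst (suc k ≤_) size≡n (firstColumnsCode-< Λ cylindric nonzero)
      rest-size : size (removeColumns Λ) ≡ n ∸ suc k
      rest-size = trans (sym (ℕ.m+n∸n≡m (size (removeColumns Λ)) (suc k))) (cong (_∸ suc k) (begin
        size (removeColumns Λ) + suc k             ≡⟨ cong (size (removeColumns Λ) +_) (sym (weight-ι k e)) ⟩
        size (removeColumns Λ) + weight (ι k e)    ≡⟨ cong (λ s → size (removeColumns Λ) + weight s) ι≡shape ⟩
        size (removeColumns Λ) + weight (shape Λ)  ≡⟨ size-removeColumns Λ cylindric ⟩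
        size Λ                                     ≡⟨ size≡n ⟩
        n                                          ∎))
        where open ≡-Reasoning
      rest-counted : Counted (n ∸ suc k) (k , e) (removeColumns Λ)
      rest-counted =
        Cylindric-removeColumns Λ cylindric , rest-size , ⊑-trans (shape-removeColumns Λ) (⊑-reflexive (sym ι≡shape))
      Λ∈w : ∀ f′ → n ≤ suc f′ → Λ ∈ withFirstColumns f′ n (k , e)
      Λ∈w f′ n≤1+f′ with suc k ℕ.≤? n
      ... | no  k≮n = contradiction k<n k≮n
      ... | yes _   = subst (_∈ map (addColumns (ι k e)) (enumerate f′ (n ∸ suc k) (k , e)))
        (trans (cong (λ s → addColumns s (removeColumns Λ)) ι≡shape) (addColumns-removeColumns Λ cylindric))
        (∈.∈-map⁺ (addColumns (ι k e)) (enumerate-complete f′ (n ∸ suc k) (k , e) (removeColumns Λ)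
          (ℕ.≤-trans (ℕ.∸-monoˡ-≤ (suc k) n≤1+f′) (ℕ.m∸n≤m f′ k)) rest-counted))
      ∈-nonempty : ∀ {f} → n ≤ f → Λ ∈ nonempty f n c
      ∈-nonempty {zero}   n≤0    = contradiction (ℕ.≤-trans k<n n≤0) λ ()
      ∈-nonempty {suc f′} n≤1+f′ = ∈.∈-concatMap⁺ (withFirstColumns f′ n) {xs = codes⊑ c}
        (lose (∈-codes⊑⁺ c (k , e) (subst (_⊑ ιᶜ c) (sym ι≡shape) Λ⊑)) (Λ∈w f′ n≤1+f′))

  empty∉nonempty : ∀ f n c → empty ∉ nonempty f n c
  empty∉nonempty (suc f) n c empty∈ with ∈-nonempty⁻ f n c empty∈
  ... | (k , e) , _ , empty∈w with trans (cong weight (withFirstColumns-shape f n k e empty∈w)) (weight-ι k e)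
  ... | ()

  withFirstColumns-disjoint : ∀ f n c c′ {Λ} →
    Λ ∈ withFirstColumns f n c → Λ ∈ withFirstColumns f n c′ → c ≡ c′
  withFirstColumns-disjoint f n (k , e) (k′ , e′) Λ∈ Λ∈′
    with ι-injective (trans (sym (withFirstColumns-shape f n k e Λ∈)) (withFirstColumns-shape f n k′ e′ Λ∈′))
  ... | refl , refl = refl

  mutual
    enumerate-unique : ∀ f n c → Unique (enumerate f n c)
    enumerate-unique f n c = Unique.++⁺ (emptyIfZero-unique n) (nonempty-unique f) disjoint
      where
      emptyIfZero-unique : ∀ n → Unique (emptyIfZero n)
      emptyIfZero-unique zero    = [] ∷ []
      emptyIfZero-unique (suc n) = []
      nonempty-unique : ∀ f → Unique (nonempty f n c)
      nonempty-unique zero    = []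
      nonempty-unique (suc f) = Unique-concatMap (withFirstColumns f n) (codes⊑-unique c) (withFirstColumns-unique f n)
        (withFirstColumns-disjoint f n _ _)
      disjoint : ∀ {Λ} → ¬ (Λ ∈ emptyIfZero n × Λ ∈ nonempty f n c)
      disjoint (Λ∈₀ , Λ∈₊) =
        empty∉nonempty f n c (subst (_∈ nonempty f n c) (proj₂ (∈-emptyIfZero n Λ∈₀)) Λ∈₊)

    withFirstColumns-unique : ∀ f n c → Unique (withFirstColumns f n c)
    withFirstColumns-unique f n (k , e) with suc k ℕ.≤? n
    ... | no  _ = []
    ... | yes _ = Unique-map (addColumns (ι k e)) removeColumns
                    (λ Λ′∈ → let Λ′-cylindric , _ , Λ′⊑ = enumerate-sound f (n ∸ suc k) (k , e) Λ′∈
                             in removeColumns-addColumns (ι k e) _ Λ′-cylindric Λ′⊑)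
                    (enumerate-unique f (n ∸ suc k) (k , e))

  mutual
    enumerate-fuel-suc : ∀ f n c → n ≤ f → enumerate f n c ≡ enumerate (suc f) n c
    enumerate-fuel-suc zero    zero c z≤n = cong (empty ∷_) (sym (no-columns (codes⊑ c)))
      where
      no-columns : ∀ cs → concatMap (withFirstColumns 0 0) cs ≡ []
      no-columns []             = refl
      no-columns ((k , e) ∷ cs) with suc k ℕ.≤? 0
      ... | no _ = no-columns cs
    enumerate-fuel-suc (suc f) n c n≤f =
      cong (emptyIfZero n ++_) (List.concatMap-cong (λ c′ → withFirstColumns-fuel-suc f n c′ n≤f) (codes⊑ c))

    withFirstColumns-fuel-suc : ∀ f n c → n ≤ suc f → withFirstColumns f n c ≡ withFirstColumns (suc f) n c
    withFirstColumns-fuel-suc f n (k , e) n≤1+f with suc k ℕ.≤? n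
    ... | no  _ = refl
    ... | yes _ = cong (map (addColumns (ι k e)))
                    (enumerate-fuel-suc f (n ∸ suc k) (k , e)
                      (ℕ.≤-trans (ℕ.∸-monoˡ-≤ (suc k) n≤1+f) (ℕ.m∸n≤m f k)))

  enumerate-fuel : ∀ f n c → n ≤ f → enumerate f n c ≡ enumerate n n c
  enumerate-fuel zero    zero c z≤n = refl
  enumerate-fuel (suc f) n    c n≤1+f with n ℕ.≟ suc f
  ... | yes refl  = refl
  ... | no  n≢1+f = trans (sym (enumerate-fuel-suc f n c n≤f)) (enumerate-fuel f n c n≤f)
    where n≤f = ℕ.≤-pred (ℕ.≤∧≢⇒< n≤1+f n≢1+f)

  partitionsOfSize : ℕ → List Triple
  partitionsOfSize n = enumerate n n (n , false)

  partitionsOfSize-unique : ∀ n → Unique (partitionsOfSize n)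
  partitionsOfSize-unique n = enumerate-unique n n (n , false)

  ∈-partitionsOfSize⇔ : ∀ n Λ → Λ ∈ partitionsOfSize n ⇔ (IsCylindric profile110 Λ × size Λ ≡ n)
  ∈-partitionsOfSize⇔ n Λ = mk⇔
    (λ Λ∈ → let cylindric , size≡n , _ = enumerate-sound n n (n , false) Λ∈
            in Equivalence.from (IsCylindric⇔Cylindric Λ) cylindric , size≡n)
    (λ (isCylindric , size≡n) → let cylindric = Equivalence.to (IsCylindric⇔Cylindric Λ) isCylindric in
       enumerate-complete n n (n , false) Λ ℕ.≤-refl
         (cylindric , size≡n , subst (λ m → shape Λ ⊑ ι m false) size≡n (shape-⊑-ι-size Λ cylindric)))

module Counting where

  open import Defs
  open PowerSeries
  open QSeries
  open Shapes
  open CylindricPartitions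
  open import Data.Nat using (ℕ; zero; suc; _+_; _∸_; z≤n; s≤s)
  import Data.Nat.Properties as ℕ
  open import Data.Integer using (+_) renaming (_+_ to _+ᶻ_)
  import Data.Integer.Properties as ℤ
  open import Data.Bool using (true; false)
  open import Data.List using (List; []; _∷_; map; concatMap; length)
  import Data.List.Properties as List
  open import Data.Product using (_,_)
  open import Relation.Binary.PropositionalEquality
  open import Relation.Nullary using (yes; no)
  open import Function using (_∘_)

  -- Coefficient n is the number of cylindric partitions of size n with shape ⊑ ιᶜ c.
  countBelow : Code → FPS
  countBelow c n = + length (enumerate n n c)

  -- Partitions whose first columns have shape ι k e: removing these columns lowers the size by k + 1
  -- and leaves a partition counted by countBelow (k , e).
  countFirstColumns : Code → FPS
  countFirstColumns (k , e) = mono (suc k) *ₛ countBelow (k , e)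

  sumOver : List Code → (Code → FPS) → FPS
  sumOver []       h = zeroS
  sumOver (c ∷ cs) h = h c +ₛ sumOver cs h

  length-withFirstColumns : ∀ m k e →
    + length (withFirstColumns m (suc m) (k , e)) ≡ countFirstColumns (k , e) (suc m)
  length-withFirstColumns m k e with suc k ℕ.≤? suc m
  ... | no  k≮m       = sym (q^∣mono-*ₛ (suc k) (countBelow (k , e)) (suc m) (ℕ.≰⇒> k≮m))
  ... | yes (s≤s k≤m) = begin
    + length (map (addColumns (ι k e)) (enumerate m (m ∸ k) (k , e)))
      ≡⟨ cong +_ (List.length-map _ (enumerate m (m ∸ k) (k , e))) ⟩
    + length (enumerate m (m ∸ k) (k , e))
      ≡⟨ cong (+_ ∘ length) (enumerate-fuel m (m ∸ k) (k , e) (ℕ.m∸n≤m m k)) ⟩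
    countBelow (k , e) (m ∸ k)
      ≡⟨ sym (mono-*ₛ-shift (suc k) (countBelow (k , e)) (m ∸ k)) ⟩
    countFirstColumns (k , e) (suc k + (m ∸ k))
      ≡⟨ cong (λ x → countFirstColumns (k , e) (suc x)) (ℕ.m+[n∸m]≡n k≤m) ⟩
    countFirstColumns (k , e) (suc m) ∎
    where
    open ≡-Reasoning

  -- A cylindric partition is empty or determined by its first columns and the rest.
  countBelow-equation : ∀ c → countBelow c ≈ oneS +ₛ sumOver (codes⊑ c) countFirstColumns
  countBelow-equation c = mk≈ λ where
      zero    → sym (cong (+ 1 +ᶻ_) (constant-term (codes⊑ c)))
      (suc m) → trans (length-nonempty m (codes⊑ c)) (sym (ℤ.+-identityˡ _))
    where
    constant-term : ∀ cs → sumOver cs countFirstColumns 0 ≡ + 0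
    constant-term []             = refl
    constant-term ((k , e) ∷ cs) =
      cong₂ _+ᶻ_ (q^∣mono-*ₛ (suc k) (countBelow (k , e)) 0 (s≤s z≤n)) (constant-term cs)
    length-nonempty : ∀ m cs →
      + length (concatMap (withFirstColumns m (suc m)) cs) ≡ sumOver cs countFirstColumns (suc m)
    length-nonempty m []             = refl
    length-nonempty m ((k , e) ∷ cs) =
      trans (cong +_ (List.length-++ (withFirstColumns m (suc m) (k , e))))
            (trans (ℤ.pos-+ (length (withFirstColumns m (suc m) (k , e))) _)
                   (cong₂ _+ᶻ_ (length-withFirstColumns m k e) (length-nonempty m cs)))

  -- Counts the cylindric partitions whose first columns have total height at most k.
  countHeight≤ : ℕ → FPS
  countHeight≤ k = oneS +ₛ sumOver (codes< k) countFirstColumns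

  countBelow-false : ∀ k → countBelow (k , false) ≈ countHeight≤ k +ₛ countFirstColumns (k , false)
  countBelow-false k = R.trans (countBelow-equation (k , false))
    (solve 3 (λ o a s → o :+ (a :+ s) := (o :+ s) :+ a) R.refl
       oneS (countFirstColumns (k , false)) (sumOver (codes< k) countFirstColumns))

  countBelow-true-zero : countBelow (0 , true) ≈ oneS +ₛ countFirstColumns (0 , true)
  countBelow-true-zero = R.trans (countBelow-equation (0 , true)) (+ₛ-congˡ oneS (R.+-identityʳ _))

  countBelow-true-suc : ∀ k → countBelow (suc k , true) ≈
    (countHeight≤ k +ₛ countFirstColumns (k , false)) +ₛ countFirstColumns (suc k , true)
  countBelow-true-suc k = R.trans (countBelow-equation (suc k , true))
    (solve 4 (λ o a b s → o :+ (a :+ (b :+ s)) := ((o :+ s) :+ b) :+ a) R.refl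
       oneS (countFirstColumns (suc k , true)) (countFirstColumns (k , false)) (sumOver (codes< k) countFirstColumns))

  countHeight≤-suc : ∀ k → countHeight≤ (suc k) ≈
    (countHeight≤ k +ₛ countFirstColumns (k , false)) +ₛ countFirstColumns (k , true)
  countHeight≤-suc k = solve 4 (λ o a b s → o :+ (a :+ (b :+ s)) := ((o :+ s) :+ a) :+ b) R.refl
    oneS (countFirstColumns (k , false)) (countFirstColumns (k , true)) (sumOver (codes< k) countFirstColumns)

  countHeight≤-zero : countHeight≤ 0 ≈ oneS
  countHeight≤-zero = R.+-identityʳ oneS

  1-q^-*ₛ-countBelow-false : ∀ k → 1-q^ suc k *ₛ countBelow (k , false) ≈ countHeight≤ k
  1-q^-*ₛ-countBelow-false k = solve-linear (mono (suc k)) (countBelow-false k)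

  1-q-*ₛ-countBelow-true-zero : 1-q^ 1 *ₛ countBelow (0 , true) ≈ oneS
  1-q-*ₛ-countBelow-true-zero = solve-linear (mono 1) countBelow-true-zero

  1-q^-*ₛ-countBelow-true-suc : ∀ k →
    1-q^ suc (suc k) *ₛ countBelow (suc k , true) ≈ countHeight≤ k +ₛ countFirstColumns (k , false)
  1-q^-*ₛ-countBelow-true-suc k = solve-linear (mono (suc (suc k))) (countBelow-true-suc k)

  qPoch-*ₛ-countHeight≤-one : qPoch 1 *ₛ countHeight≤ 1 ≈ fib 0 1
  qPoch-*ₛ-countHeight≤-one = begin
    (oneS *ₛ 1-q^ 1) *ₛ countHeight≤ 1
      ≈⟨ *ₛ-cong (*ₛ-identityˡ (1-q^ 1)) (countHeight≤-suc 0) ⟩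
    1-q^ 1 *ₛ ((G +ₛ x *ₛ A) +ₛ x *ₛ B)
      ≈⟨ solve 4 (λ g x a b → (:con (+ 1) :- x) :* ((g :+ x :* a) :+ x :* b)
                              := (:con (+ 1) :- x) :* g :+ x :* ((:con (+ 1) :- x) :* a) :+ x :* ((:con (+ 1) :- x) :* b))
                 R.refl G x A B ⟩
    1-q^ 1 *ₛ G +ₛ x *ₛ (1-q^ 1 *ₛ A) +ₛ x *ₛ (1-q^ 1 *ₛ B)
      ≈⟨ R.+-cong (R.+-cong (*ₛ-congˡ (1-q^ 1) countHeight≤-zero)
                            (*ₛ-congˡ x (R.trans (1-q^-*ₛ-countBelow-false 0) countHeight≤-zero)))
                  (*ₛ-congˡ x 1-q-*ₛ-countBelow-true-zero) ⟩
    1-q^ 1 *ₛ oneS +ₛ x *ₛ oneS +ₛ x *ₛ oneS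
      ≈⟨ solve 1 (λ x → (:con (+ 1) :- x) :* :con (+ 1) :+ x :* :con (+ 1) :+ x :* :con (+ 1) := :con (+ 1) :+ x)
                 R.refl x ⟩
    oneS +ₛ x ∎
    where
    open ≈-Reasoning
    G = countHeight≤ 0
    x = mono 1
    A = countBelow (0 , false)
    B = countBelow (0 , true)

  qPoch-*ₛ-countHeight≤-recurrence : ∀ k →
    qPoch (2 + k) *ₛ countHeight≤ (2 + k) ≈
    qPoch (1 + k) *ₛ countHeight≤ (1 + k) +ₛ mono (2 + k) *ₛ (qPoch k *ₛ countHeight≤ k)
  qPoch-*ₛ-countHeight≤-recurrence k = begin
    (P₁ *ₛ b) *ₛ countHeight≤ (2 + k)
      ≈⟨ *ₛ-congˡ (P₁ *ₛ b) (countHeight≤-suc (suc k)) ⟩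
    (P₁ *ₛ b) *ₛ ((G₁ +ₛ x *ₛ F₁) +ₛ x *ₛ T₁)
      ≈⟨ solve 6 (λ p b g x f t → (p :* b) :* ((g :+ x :* f) :+ x :* t)
                                  := p :* (b :* g) :+ x :* (p :* (b :* f)) :+ x :* (p :* (b :* t)))
                 R.refl P₁ b G₁ x F₁ T₁ ⟩
    P₁ *ₛ (b *ₛ G₁) +ₛ x *ₛ (P₁ *ₛ (b *ₛ F₁)) +ₛ x *ₛ (P₁ *ₛ (b *ₛ T₁))
      ≈⟨ R.+-cong (+ₛ-congˡ (P₁ *ₛ (b *ₛ G₁)) (*ₛ-congˡ x (*ₛ-congˡ P₁ (1-q^-*ₛ-countBelow-false (suc k)))))
                  (*ₛ-congˡ x (*ₛ-congˡ P₁ (1-q^-*ₛ-countBelow-true-suc k))) ⟩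
    front +ₛ x *ₛ (P₁ *ₛ (G₀ +ₛ y *ₛ F₀))
      ≈⟨ +ₛ-congˡ front (*ₛ-congˡ x
           (solve 5 (λ p a g y f → (p :* a) :* (g :+ y :* f) := p :* (a :* g) :+ y :* (p :* (a :* f)))
                    R.refl P a G₀ y F₀)) ⟩
    front +ₛ x *ₛ (P *ₛ (a *ₛ G₀) +ₛ y *ₛ (P *ₛ (a *ₛ F₀)))
      ≈⟨ +ₛ-congˡ front (*ₛ-congˡ x (+ₛ-congˡ (P *ₛ (a *ₛ G₀))
           (*ₛ-congˡ y (*ₛ-congˡ P (1-q^-*ₛ-countBelow-false k))))) ⟩
    front +ₛ x *ₛ (P *ₛ (a *ₛ G₀) +ₛ y *ₛ (P *ₛ G₀))
      ≈⟨ solve 5 (λ p g h x y →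
           (p :* (:con (+ 1) :- y)) :* ((:con (+ 1) :- x) :* g) :+ x :* ((p :* (:con (+ 1) :- y)) :* g)
             :+ x :* (p :* ((:con (+ 1) :- y) :* h) :+ y :* (p :* h))
           := (p :* (:con (+ 1) :- y)) :* g :+ x :* (p :* h)) R.refl P G₁ G₀ x y ⟩
    P₁ *ₛ G₁ +ₛ x *ₛ (P *ₛ G₀) ∎
    where
    open ≈-Reasoning
    P = qPoch k
    a = 1-q^ suc k
    P₁ = qPoch (suc k)
    b = 1-q^ suc (suc k)
    x = mono (2 + k)
    y = mono (suc k)
    G₀ = countHeight≤ k
    G₁ = countHeight≤ (suc k)
    F₀ = countBelow (k , false)
    F₁ = countBelow (suc k , false)
    T₁ = countBelow (suc k , true)
    front = P₁ *ₛ (b *ₛ G₁) +ₛ x *ₛ (P₁ *ₛ G₁)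

  qPoch-*ₛ-countHeight≤ : ∀ k → qPoch k *ₛ countHeight≤ k ≈ fib 0 k
  qPoch-*ₛ-countHeight≤ zero          = R.trans (*ₛ-identityˡ (countHeight≤ 0)) countHeight≤-zero
  qPoch-*ₛ-countHeight≤ (suc zero)    = qPoch-*ₛ-countHeight≤-one
  qPoch-*ₛ-countHeight≤ (suc (suc k)) = R.trans (qPoch-*ₛ-countHeight≤-recurrence k)
    (R.+-cong (qPoch-*ₛ-countHeight≤ (suc k)) (*ₛ-congˡ (mono (2 + k)) (qPoch-*ₛ-countHeight≤ k)))

  -- Partitions of size n have first columns of total height at most n.
  countBelow-coefficient : ∀ n → countBelow (n , false) n ≡ (fib 0 n *ₛ 1/qPoch n) n
  countBelow-coefficient n = begin
    countBelow (n , false) n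
      ≡⟨ at (countBelow-false n) n ⟩
    countHeight≤ n n +ᶻ countFirstColumns (n , false) n
      ≡⟨ cong (countHeight≤ n n +ᶻ_) (q^∣mono-*ₛ (suc n) (countBelow (n , false)) n ℕ.≤-refl) ⟩
    countHeight≤ n n +ᶻ + 0
      ≡⟨ ℤ.+-identityʳ _ ⟩
    countHeight≤ n n
      ≡⟨ at countHeight≤≈ n ⟩
    (fib 0 n *ₛ 1/qPoch n) n ∎
    where
    open ≡-Reasoning
    countHeight≤≈ : countHeight≤ n ≈ fib 0 n *ₛ 1/qPoch n
    countHeight≤≈ =
      *ₛ≈⇒≈*ₛ-invS (qPoch n) (countHeight≤ n) (fib 0 n) (qPoch-const n) (qPoch-*ₛ-countHeight≤ n)

open import Defs
open PowerSeries
open QSeries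
open CylindricPartitions
open Counting
open import Data.Nat using (ℕ)
import Data.Nat.Properties as ℕ
open import Data.Integer using (+_)
open import Data.Vec using (Vec)
open import Data.List using (List; length)
open import Data.Product using (Σ; _×_; _,_)
open import Relation.Binary.PropositionalEquality using (_≡_; refl; sym; trans)

theorem4p4 : (n : ℕ) →
    Σ ℕ λ k →
      HasCount (λ (Λ : Vec (List ℕ) 3) → IsCylindric profile110 Λ × (size Λ ≡ n)) k
      × (rhs110 n ≡ + k)
theorem4p4 n =
  length (partitionsOfSize n) ,
  (partitionsOfSize n , refl , partitionsOfSize-unique n , ∈-partitionsOfSize⇔ n) ,
  trans (at≤ (rhs110≈[]fib*ₛ1/qPoch n) n ℕ.≤-refl) (sym (countBelow-coefficient n))
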